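{- Let $n=p_1p_2\cdots p_t$, where $t\ge 3$ is odd and $p_1,\ldots,p_t$ are odd primes satisfying $p_1<p_2<\cdots<p_r<p_1+p_2<p_{r+1}<\cdots<p_t$ for some index $r$ (the condition $p_1+p_2<p_{r+1}$ being vacuous if $r=t$). Then each of the integers $-(r-2),-(r-3),\ldots,r-2,r-1$ is a coefficient of the cyclotomic polynomial $\Phi_{2n}(x)$. Furthermore, if $1+p_r<p_1+p_2$, then $1-r$ is also a coefficient of $\Phi_{2n}(x)$.
   Context: $\Phi_m(x)$ denotes the $m$-th cyclotomic polynomial, the minimal polynomial over $\mathbb{Q}$ of a primitive $m$-th root of unity. -}

module Defs where

open import Data.Nat as ℕ using (ℕ; zero; suc; _∸_)
open import Data.Nat.Divisibility using (_∣?_)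
open import Data.Integer as ℤ using (ℤ; +_; -_; _-_)
open import Data.List using (List; []; _∷_; _++_; reverse; length; drop; map; replicate; foldr)
open import Data.Product using (Σ; _×_; _,_)
open import Relation.Nullary.Decidable using (does)
open import Data.Bool using (if_then_else_)
open import Relation.Binary.PropositionalEquality using (_≡_)

-- Integer polynomials as little-endian coefficient lists:
-- [a₀, a₁, …, a_d] represents a₀ + a₁x + … + a_d x^d.
Poly : Set
Poly = List ℤ

infixl 6 _+ₚ_
infixl 7 _*ₚ_

_+ₚ_ : Poly → Poly → Poly
[] +ₚ q = q
(a ∷ p) +ₚ [] = a ∷ p
(a ∷ p) +ₚ (b ∷ q) = (a ℤ.+ b) ∷ (p +ₚ q)

_*ₚ_ : Poly → Poly → Poly
[] *ₚ q = []
(a ∷ p) *ₚ q = map (a ℤ.*_) q +ₚ (+ 0 ∷ (p *ₚ q))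

xPowMinusOne : ℕ → Poly
xPowMinusOne zero = + 0 ∷ []
xPowMinusOne (suc k) = - (+ 1) ∷ (replicate k (+ 0) ++ (+ 1 ∷ []))

-- f - h on the common prefix (coefficients listed from the top)
subPrefix : List ℤ → List ℤ → List ℤ
subPrefix f [] = f
subPrefix [] (b ∷ h) = (- b) ∷ subPrefix [] h
subPrefix (a ∷ f) (b ∷ h) = (a - b) ∷ subPrefix f h

-- Long division by a monic polynomial, working on coefficient lists
-- written from the highest degree down. The divisor is given without its
-- leading coefficient 1.  The first argument is the number of quotient
-- coefficients to produce.
quotRev : ℕ → List ℤ → List ℤ → List ℤ
quotRev zero f g = []
quotRev (suc k) [] g = []
quotRev (suc k) (c ∷ f) g = c ∷ quotRev k (subPrefix f (map (c ℤ.*_) g)) g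

divMonic : Poly → Poly → Poly
divMonic f g =
  reverse (quotRev (suc (length f ∸ length g)) (reverse f) (drop 1 (reverse g)))

prodDiv : ℕ → List (Σ ℕ (λ _ → Poly)) → Poly
prodDiv m = foldr (λ { (d , p) acc → if does (d ∣? m) then p *ₚ acc else acc }) (+ 1 ∷ [])

-- cycTable k = [(1 , Φ₁), …, (k , Φ_k)], via x^m - 1 = ∏_{d ∣ m} Φ_d.
cycTable : ℕ → List (Σ ℕ (λ _ → Poly))
cycTable zero = []
cycTable (suc k) =
  cycTable k ++ ((suc k , divMonic (xPowMinusOne (suc k)) (prodDiv (suc k) (cycTable k))) ∷ [])

-- Φ m : the m-th cyclotomic polynomial (m ≥ 1), coefficients a₀ … a_{φ(m)},
-- leading coefficient 1.  (Φ 0 is a meaningless convention, never used.)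
Φ : ℕ → Poly
Φ zero = + 1 ∷ []
Φ (suc k) = divMonic (xPowMinusOne (suc k)) (prodDiv (suc k) (cycTable k))

coeff : Poly → ℕ → ℤ
coeff [] k = + 0
coeff (a ∷ p) zero = a
coeff (a ∷ p) (suc k) = coeff p k

IsCoefficientOf : ℤ → Poly → Set
IsCoefficientOf c P = Σ ℕ (λ k → (k ℕ.< length P) × (coeff P k ≡ c))

prodRange : (ℕ → ℕ) → ℕ → ℕ
prodRange p zero = 1
prodRange p (suc t) = prodRange p t ℕ.* p (suc t)

{-# OPTIONS --safe #-}
module Submission where

open import Defs
open import Data.Nat using (ℕ; suc; _≤_; _<_)
open import Data.Nat.Divisibility using (_∣_)
open import Data.Nat.Primality using (Prime)
open import Data.Product using (_×_; _,_)
open import Relation.Nullary using (¬_)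

-- Write Φʳ d = y^{φ(d)} Φ_d(1/y) for the reciprocal of Φ_d, N = 2 p₁ ⋯ p_t and K = p₁ + p₂.
-- For squarefree d, Φ_d = ∏_{e ∣ d} (x^e - 1)^{μ(d/e)}; modulo y^K only the factors with
-- e ∈ {1, 2, p_j, 2p_j} survive (p_i p_j ≥ p_i + p_j ≥ K), so Φʳ d ≡ num d / den d for explicit
-- products num d, den d of binomials 1 ∓ y^e. This is proved by induction over the divisors of N
-- from x^m - 1 = ∏_{d ∣ m} Φ_d, which is how Defs computes Φ. Since t is odd,
-- (1 + y) Φʳ N ≡ ∏_j (1 + y^{p_j}) ≡ 1 + Σ_j y^{p_j}, so the coefficient of y^k in Φʳ N is
-- (-1)^k (1 - #{j : p_j ≤ k}) for k < K. At k = p_j and k = p_j + 1 with j ≤ r (so p_j < K)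
-- it equals j - 1 and 1 - j, and it is a coefficient of Φ_N because deg Φ_N = φ(N) ≥ K.

module Arithmetic where

  open import Data.Nat as ℕ using (ℕ; zero; suc; _∸_; z≤n; s≤s; _≤_; _<_)
  import Data.Nat.Properties as ℕ
  open import Data.Nat.Solver using (module +-*-Solver)
  open +-*-Solver using (solve; con; _:+_; _:*_; _:=_)
  open import Data.Integer using (-_; -1ℤ; _^_)
  import Data.Integer.Properties as ℤ
  open import Relation.Binary.PropositionalEquality using (_≡_; refl; subst; trans; cong)
  open import Data.Nat.Divisibility using (_∣_; _∤_; divides; ∣-refl; ∣m∣n⇒∣m+n)
  open import Data.Nat.Coprimality using (Coprime)
  open import Data.Nat.Primality using (Prime; prime⇒irreducible)
  open import Data.Product using (_,_)
  open import Data.Sum using (_⊎_; inj₁; inj₂)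
  open import Function using (case_of_)
  open import Relation.Nullary.Negation using (contradiction)

  m+n≤m*n : ∀ {m n} → 2 ≤ m → 2 ≤ n → m ℕ.+ n ≤ m ℕ.* n
  m+n≤m*n {suc (suc x)} {suc (suc y)} (s≤s (s≤s z≤n)) (s≤s (s≤s z≤n)) = begin
    (2 ℕ.+ x) ℕ.+ (2 ℕ.+ y)                               ≤⟨ ℕ.m≤m+n _ (x ℕ.+ y ℕ.+ x ℕ.* y) ⟩
    (2 ℕ.+ x) ℕ.+ (2 ℕ.+ y) ℕ.+ (x ℕ.+ y ℕ.+ x ℕ.* y)     ≡⟨ solve 2 (λ x y → (con 2 :+ x) :+ (con 2 :+ y) :+ (x :+ y :+ x :* y)
                                                                          := (con 2 :+ x) :* (con 2 :+ y)) refl x y ⟩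
    (2 ℕ.+ x) ℕ.* (2 ℕ.+ y)                               ∎
    where open ℕ.≤-Reasoning

  m+n≤1+[m∸1]*[n∸1] : ∀ {m n} → 3 ≤ m → 4 ≤ n → m ℕ.+ n ≤ suc ((m ∸ 1) ℕ.* (n ∸ 1))
  m+n≤1+[m∸1]*[n∸1] {suc (suc (suc x))} {suc (suc (suc (suc y)))} (s≤s (s≤s (s≤s z≤n))) (s≤s (s≤s (s≤s (s≤s z≤n)))) = begin
    (3 ℕ.+ x) ℕ.+ (4 ℕ.+ y)                               ≤⟨ ℕ.m≤m+n _ (x ℕ.+ x ℕ.+ y ℕ.+ x ℕ.* y) ⟩
    (3 ℕ.+ x) ℕ.+ (4 ℕ.+ y) ℕ.+ (x ℕ.+ x ℕ.+ y ℕ.+ x ℕ.* y) ≡⟨ solve 2 (λ x y → (con 3 :+ x) :+ (con 4 :+ y) :+ (x :+ x :+ y :+ x :* y)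
                                                                          := con 1 :+ (con 2 :+ x) :* (con 3 :+ y)) refl x y ⟩
    suc ((2 ℕ.+ x) ℕ.* (3 ℕ.+ y))                         ∎
    where open ℕ.≤-Reasoning

  2∣n⊎2∣1+n : ∀ n → 2 ∣ n ⊎ 2 ∣ suc n
  2∣n⊎2∣1+n zero = inj₁ (divides 0 refl)
  2∣n⊎2∣1+n (suc n) with 2∣n⊎2∣1+n n
  ... | inj₁ 2∣n = inj₂ (∣m∣n⇒∣m+n ∣-refl 2∣n)
  ... | inj₂ 2∣1+n = inj₁ 2∣1+n

  odd-m<n⇒1+m<n : ∀ {m n} → 2 ∤ m → 2 ∤ n → m < n → suc m < n
  odd-m<n⇒1+m<n {m} 2∤m 2∤n m<n = ℕ.≤∧≢⇒< m<n λ 1+m≡n → case 2∣n⊎2∣1+n m of λ where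
    (inj₁ 2∣m) → 2∤m 2∣m
    (inj₂ 2∣1+m) → 2∤n (subst (2 ∣_) 1+m≡n 2∣1+m)

  prime-∤⇒coprime : ∀ {q d} → Prime q → q ∤ d → Coprime d q
  prime-∤⇒coprime q-prime q∤d {i} (i∣d , i∣q) with prime⇒irreducible q-prime i∣q
  ... | inj₁ i≡1 = i≡1
  ... | inj₂ refl = contradiction i∣d q∤d

  2∤2+n⇒2∤n : ∀ {n} → 2 ∤ suc (suc n) → 2 ∤ n
  2∤2+n⇒2∤n 2∤2+n 2∣n = 2∤2+n (∣m∣n⇒∣m+n ∣-refl 2∣n)

  -1^-odd : ∀ n → 2 ∤ n → -1ℤ ^ n ≡ -1ℤ
  -1^-odd zero 2∤0 = contradiction (divides 0 refl) 2∤0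
  -1^-odd (suc zero) _ = refl
  -1^-odd (suc (suc n)) 2∤2+n = trans (-1^-double n) (-1^-odd n (2∤2+n⇒2∤n 2∤2+n))
    where
    -1^-double : ∀ n → -1ℤ ^ suc (suc n) ≡ -1ℤ ^ n
    -1^-double n = trans (ℤ.-1*i≡-i _) (trans (cong -_ (ℤ.-1*i≡-i _)) (ℤ.neg-involutive _))

module PowerSeries where

  open import Data.Bool using (true; false; if_then_else_)
  open import Data.Nat as ℕ using (ℕ; zero; suc; z≤n; s≤s)
  import Data.Nat.Properties as ℕ
  open import Data.Integer using (ℤ; 0ℤ; 1ℤ; -1ℤ; _+_; _*_)
  import Data.Integer.Properties as ℤ
  open import Data.Integer.Solver using (module +-*-Solver)
  open import Data.Product using (_,_)
  open import Data.Sum using (inj₁; inj₂)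
  open import Function using (_∘_)
  open import Level using (0ℓ)
  open import Algebra.Bundles using (CommutativeMonoid; AbelianGroup)
  import Algebra.Properties.Group as GroupProperties
  open import Relation.Binary.PropositionalEquality
  open +-*-Solver using (solve; _:+_; _:*_; _:=_; con)
  open ≡-Reasoning

  Series : Set
  Series = ℕ → ℤ

  infixl 6 _+ₛ_
  infixl 7 _*ₛ_ _·ₛ_

  1ₛ : Series
  1ₛ zero = 1ℤ
  1ₛ (suc _) = 0ℤ

  _+ₛ_ : Series → Series → Series
  (f +ₛ g) k = f k + g k

  _·ₛ_ : ℤ → Series → Series
  (c ·ₛ f) k = c * f k

  -- The Cauchy product, by recursion on the first factor: f g = f₀ g + y ((f ∘ suc) g).
  _*ₛ_ : Series → Series → Series
  (f *ₛ g) zero = f 0 * g 0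
  (f *ₛ g) (suc k) = f 0 * g (suc k) + (f ∘ suc *ₛ g) k

  shift : Series → Series
  shift f zero = 0ℤ
  shift f (suc k) = f k

  shiftBy : ℕ → Series → Series
  shiftBy zero f = f
  shiftBy (suc n) f = shift (shiftBy n f)

  y^ : ℕ → Series
  y^ n = shiftBy n 1ₛ

  1-y^ 1+y^ : ℕ → Series
  1-y^ n = 1ₛ +ₛ -1ℤ ·ₛ y^ n
  1+y^ n = 1ₛ +ₛ y^ n

  IsZero : Series → Set
  IsZero f = ∀ i → f i ≡ 0ℤ

  *ₛ-zeroˡ : ∀ {f} g → IsZero f → IsZero (f *ₛ g)
  *ₛ-zeroˡ g f≡0 zero = cong (_* g 0) (f≡0 0)
  *ₛ-zeroˡ g f≡0 (suc k) = cong₂ (λ a b → a * g (suc k) + b) (f≡0 0) (*ₛ-zeroˡ g (f≡0 ∘ suc) k)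

  *ₛ-cong : ∀ {f f′ g g′} → f ≗ f′ → g ≗ g′ → f *ₛ g ≗ f′ *ₛ g′
  *ₛ-cong f≗ g≗ zero = cong₂ _*_ (f≗ 0) (g≗ 0)
  *ₛ-cong f≗ g≗ (suc k) = cong₂ _+_ (cong₂ _*_ (f≗ 0) (g≗ (suc k))) (*ₛ-cong (f≗ ∘ suc) g≗ k)

  *ₛ-cong-upTo : ∀ {f f′ g g′} k → (∀ i → i ℕ.≤ k → f i ≡ f′ i) → (∀ i → i ℕ.≤ k → g i ≡ g′ i) →
    (f *ₛ g) k ≡ (f′ *ₛ g′) k
  *ₛ-cong-upTo zero f≡ g≡ = cong₂ _*_ (f≡ 0 z≤n) (g≡ 0 z≤n)
  *ₛ-cong-upTo (suc k) f≡ g≡ =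
    cong₂ _+_ (cong₂ _*_ (f≡ 0 z≤n) (g≡ (suc k) ℕ.≤-refl))
      (*ₛ-cong-upTo k (λ i i≤k → f≡ (suc i) (s≤s i≤k)) (λ i i≤k → g≡ i (ℕ.m≤n⇒m≤1+n i≤k)))

  *ₛ-sucʳ : ∀ f g k → (f *ₛ g) (suc k) ≡ f (suc k) * g 0 + (f *ₛ g ∘ suc) k
  *ₛ-sucʳ f g zero = ℤ.+-comm (f 0 * g 1) (f 1 * g 0)
  *ₛ-sucʳ f g (suc k) = begin
    f 0 * g (suc (suc k)) + (f ∘ suc *ₛ g) (suc k)
      ≡⟨ cong ((f 0 * g (suc (suc k))) +_) (*ₛ-sucʳ (f ∘ suc) g k) ⟩
    f 0 * g (suc (suc k)) + (f (suc (suc k)) * g 0 + (f ∘ suc *ₛ g ∘ suc) k)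
      ≡⟨ solve 3 (λ a b c → a :+ (b :+ c) := b :+ (a :+ c)) refl
           (f 0 * g (suc (suc k))) (f (suc (suc k)) * g 0) ((f ∘ suc *ₛ g ∘ suc) k) ⟩
    f (suc (suc k)) * g 0 + (f 0 * g (suc (suc k)) + (f ∘ suc *ₛ g ∘ suc) k)
      ∎

  *ₛ-comm : ∀ f g → f *ₛ g ≗ g *ₛ f
  *ₛ-comm f g zero = ℤ.*-comm (f 0) (g 0)
  *ₛ-comm f g (suc k) = begin
    f 0 * g (suc k) + (f ∘ suc *ₛ g) k
      ≡⟨ cong₂ _+_ (ℤ.*-comm (f 0) (g (suc k))) (*ₛ-comm (f ∘ suc) g k) ⟩
    g (suc k) * f 0 + (g *ₛ f ∘ suc) k
      ≡⟨ *ₛ-sucʳ g f k ⟨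
    (g *ₛ f) (suc k)
      ∎

  *ₛ-unfoldˡ : ∀ f g → f *ₛ g ≗ f 0 ·ₛ g +ₛ shift (f ∘ suc *ₛ g)
  *ₛ-unfoldˡ f g zero = sym (ℤ.+-identityʳ _)
  *ₛ-unfoldˡ f g (suc k) = refl

  *ₛ-zeroʳ : ∀ f {g} → IsZero g → IsZero (f *ₛ g)
  *ₛ-zeroʳ f {g} g≡0 k = trans (*ₛ-comm f g k) (*ₛ-zeroˡ f g≡0 k)

  *ₛ-distribʳ-+ₛ : ∀ f f′ g → (f +ₛ f′) *ₛ g ≗ f *ₛ g +ₛ f′ *ₛ g
  *ₛ-distribʳ-+ₛ f f′ g zero = ℤ.*-distribʳ-+ (g 0) (f 0) (f′ 0)
  *ₛ-distribʳ-+ₛ f f′ g (suc k) = begin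
    (f 0 + f′ 0) * g (suc k) + ((f +ₛ f′) ∘ suc *ₛ g) k
      ≡⟨ cong (((f 0 + f′ 0) * g (suc k)) +_) (*ₛ-distribʳ-+ₛ (f ∘ suc) (f′ ∘ suc) g k) ⟩
    (f 0 + f′ 0) * g (suc k) + ((f ∘ suc *ₛ g) k + (f′ ∘ suc *ₛ g) k)
      ≡⟨ solve 5 (λ a b c d e → (a :+ b) :* c :+ (d :+ e) := (a :* c :+ d) :+ (b :* c :+ e)) refl
           (f 0) (f′ 0) (g (suc k)) ((f ∘ suc *ₛ g) k) ((f′ ∘ suc *ₛ g) k) ⟩
    (f 0 * g (suc k) + (f ∘ suc *ₛ g) k) + (f′ 0 * g (suc k) + (f′ ∘ suc *ₛ g) k)
      ∎

  *ₛ-distribˡ-+ₛ : ∀ f g g′ → f *ₛ (g +ₛ g′) ≗ f *ₛ g +ₛ f *ₛ g′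
  *ₛ-distribˡ-+ₛ f g g′ k = begin
    (f *ₛ (g +ₛ g′)) k       ≡⟨ *ₛ-comm f (g +ₛ g′) k ⟩
    ((g +ₛ g′) *ₛ f) k       ≡⟨ *ₛ-distribʳ-+ₛ g g′ f k ⟩
    (g *ₛ f +ₛ g′ *ₛ f) k    ≡⟨ cong₂ _+_ (*ₛ-comm g f k) (*ₛ-comm g′ f k) ⟩
    (f *ₛ g +ₛ f *ₛ g′) k    ∎

  *ₛ-·ₛ-assoc : ∀ c f g → (c ·ₛ f) *ₛ g ≗ c ·ₛ (f *ₛ g)
  *ₛ-·ₛ-assoc c f g zero = ℤ.*-assoc c (f 0) (g 0)
  *ₛ-·ₛ-assoc c f g (suc k) = begin
    c * f 0 * g (suc k) + ((c ·ₛ f) ∘ suc *ₛ g) k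
      ≡⟨ cong ((c * f 0 * g (suc k)) +_) (*ₛ-·ₛ-assoc c (f ∘ suc) g k) ⟩
    c * f 0 * g (suc k) + c * (f ∘ suc *ₛ g) k
      ≡⟨ solve 4 (λ a b d e → a :* b :* d :+ a :* e := a :* (b :* d :+ e)) refl
           c (f 0) (g (suc k)) ((f ∘ suc *ₛ g) k) ⟩
    c * (f 0 * g (suc k) + (f ∘ suc *ₛ g) k)
      ∎

  *ₛ-assoc : ∀ f g h → (f *ₛ g) *ₛ h ≗ f *ₛ (g *ₛ h)
  *ₛ-assoc f g h zero = ℤ.*-assoc (f 0) (g 0) (h 0)
  *ₛ-assoc f g h (suc k) = begin
    (f *ₛ g) 0 * h (suc k) + ((f *ₛ g) ∘ suc *ₛ h) k
      ≡⟨⟩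
    f 0 * g 0 * h (suc k) + ((f 0 ·ₛ g ∘ suc +ₛ f ∘ suc *ₛ g) *ₛ h) k
      ≡⟨ cong ((f 0 * g 0 * h (suc k)) +_) (*ₛ-distribʳ-+ₛ (f 0 ·ₛ g ∘ suc) (f ∘ suc *ₛ g) h k) ⟩
    f 0 * g 0 * h (suc k) + ((f 0 ·ₛ g ∘ suc *ₛ h) k + (f ∘ suc *ₛ g *ₛ h) k)
      ≡⟨ cong₂ (λ u v → f 0 * g 0 * h (suc k) + (u + v))
           (*ₛ-·ₛ-assoc (f 0) (g ∘ suc) h k) (*ₛ-assoc (f ∘ suc) g h k) ⟩
    f 0 * g 0 * h (suc k) + (f 0 * (g ∘ suc *ₛ h) k + (f ∘ suc *ₛ (g *ₛ h)) k)
      ≡⟨ solve 5 (λ a b c d e → a :* b :* c :+ (a :* d :+ e) := a :* (b :* c :+ d) :+ e) refl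
           (f 0) (g 0) (h (suc k)) ((g ∘ suc *ₛ h) k) ((f ∘ suc *ₛ (g *ₛ h)) k) ⟩
    f 0 * (g *ₛ h) (suc k) + (f ∘ suc *ₛ (g *ₛ h)) k
      ∎

  *ₛ-identityˡ : ∀ g → 1ₛ *ₛ g ≗ g
  *ₛ-identityˡ g zero = ℤ.*-identityˡ (g 0)
  *ₛ-identityˡ g (suc k) =
    trans (cong₂ _+_ (ℤ.*-identityˡ (g (suc k))) (*ₛ-zeroˡ g (λ _ → refl) k)) (ℤ.+-identityʳ _)

  *ₛ-identityʳ : ∀ f → f *ₛ 1ₛ ≗ f
  *ₛ-identityʳ f k = trans (*ₛ-comm f 1ₛ k) (*ₛ-identityˡ f k)

  shift-cong : ∀ {f g} → f ≗ g → shift f ≗ shift g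
  shift-cong f≗g zero = refl
  shift-cong f≗g (suc k) = f≗g k

  shiftBy-cong : ∀ n {f g} → f ≗ g → shiftBy n f ≗ shiftBy n g
  shiftBy-cong zero f≗g = f≗g
  shiftBy-cong (suc n) f≗g = shift-cong (shiftBy-cong n f≗g)

  *ₛ-shiftˡ : ∀ f g → shift f *ₛ g ≗ shift (f *ₛ g)
  *ₛ-shiftˡ f g zero = refl
  *ₛ-shiftˡ f g (suc k) = ℤ.+-identityˡ _

  *ₛ-shiftʳ : ∀ f g → f *ₛ shift g ≗ shift (f *ₛ g)
  *ₛ-shiftʳ f g k = trans (*ₛ-comm f (shift g) k) (trans (*ₛ-shiftˡ g f k) (shift-cong (*ₛ-comm g f) k))

  *ₛ-shiftByˡ : ∀ n f g → shiftBy n f *ₛ g ≗ shiftBy n (f *ₛ g)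
  *ₛ-shiftByˡ zero f g k = refl
  *ₛ-shiftByˡ (suc n) f g k = trans (*ₛ-shiftˡ (shiftBy n f) g k) (shift-cong (*ₛ-shiftByˡ n f g) k)

  shift-·ₛ : ∀ c f → shift (c ·ₛ f) ≗ c ·ₛ shift f
  shift-·ₛ c f zero = sym (ℤ.*-zeroʳ c)
  shift-·ₛ c f (suc k) = refl

  shiftBy-·ₛ : ∀ n c f → shiftBy n (c ·ₛ f) ≗ c ·ₛ shiftBy n f
  shiftBy-·ₛ zero c f k = refl
  shiftBy-·ₛ (suc n) c f k = trans (shift-cong (shiftBy-·ₛ n c f) k) (shift-·ₛ c (shiftBy n f) k)

  shiftBy-+ : ∀ m n f → shiftBy m (shiftBy n f) ≗ shiftBy (m ℕ.+ n) f
  shiftBy-+ zero n f k = refl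
  shiftBy-+ (suc m) n f = shift-cong (shiftBy-+ m n f)

  shiftBy-below : ∀ n f {k} → k ℕ.< n → shiftBy n f k ≡ 0ℤ
  shiftBy-below (suc n) f {zero} _ = refl
  shiftBy-below (suc n) f {suc k} (s≤s k<n) = shiftBy-below n f k<n

  shiftBy-+ˡ : ∀ n f i → shiftBy n f (n ℕ.+ i) ≡ f i
  shiftBy-+ˡ zero f i = refl
  shiftBy-+ˡ (suc n) f i = shiftBy-+ˡ n f i

  *ₛ-y^ˡ : ∀ n f → y^ n *ₛ f ≗ shiftBy n f
  *ₛ-y^ˡ n f k = trans (*ₛ-shiftByˡ n 1ₛ f k) (shiftBy-cong n (*ₛ-identityˡ f) k)

  y^-+ : ∀ m n → y^ m *ₛ y^ n ≗ y^ (m ℕ.+ n)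
  y^-+ m n k = trans (*ₛ-y^ˡ m (y^ n) k) (shiftBy-+ m n 1ₛ k)

  *ₛ-1+y^ʳ : ∀ f n → f *ₛ 1+y^ n ≗ f +ₛ shiftBy n f
  *ₛ-1+y^ʳ f n k = trans (*ₛ-distribˡ-+ₛ f 1ₛ (y^ n) k)
    (cong₂ _+_ (*ₛ-identityʳ f k) (trans (*ₛ-comm f (y^ n) k) (*ₛ-y^ˡ n f k)))

  1-y^*1+y^ : ∀ n → 1-y^ n *ₛ 1+y^ n ≗ 1-y^ (n ℕ.+ n)
  1-y^*1+y^ n k = begin
    (1-y^ n *ₛ 1+y^ n) k
      ≡⟨ *ₛ-distribʳ-+ₛ 1ₛ (-1ℤ ·ₛ y^ n) (1+y^ n) k ⟩
    (1ₛ *ₛ 1+y^ n) k + (-1ℤ ·ₛ y^ n *ₛ 1+y^ n) k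
      ≡⟨ cong₂ _+_ (*ₛ-identityˡ (1+y^ n) k)
           (trans (*ₛ-·ₛ-assoc -1ℤ (y^ n) (1+y^ n) k)
             (cong (-1ℤ *_) (trans (*ₛ-distribˡ-+ₛ (y^ n) 1ₛ (y^ n) k)
               (cong₂ _+_ (*ₛ-identityʳ (y^ n) k) (y^-+ n n k))))) ⟩
    (1ₛ k + y^ n k) + -1ℤ * (y^ n k + y^ (n ℕ.+ n) k)
      ≡⟨ solve 3 (λ d x y → (d :+ x) :+ con -1ℤ :* (x :+ y) := d :+ con -1ℤ :* y) refl
           (1ₛ k) (y^ n k) (y^ (n ℕ.+ n) k) ⟩
    1-y^ (n ℕ.+ n) k
      ∎

  infix 4 _≈[_]_

  _≈[_]_ : Series → ℕ → Series → Set
  f ≈[ K ] g = ∀ i → i ℕ.< K → f i ≡ g i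

  ≈[]-extend : ∀ {f g} {K} → f ≈[ K ] g → f K ≡ g K → f ≈[ suc K ] g
  ≈[]-extend {K = K} f≈g fK≡gK i (s≤s i≤K) with ℕ.m≤n⇒m<n∨m≡n i≤K
  ... | inj₁ i<K = f≈g i i<K
  ... | inj₂ refl = fK≡gK

  1-y^≈1ₛ : ∀ {K} m → K ℕ.≤ m → 1-y^ m ≈[ K ] 1ₛ
  1-y^≈1ₛ m K≤m k k<K =
    trans (cong (λ z → 1ₛ k + -1ℤ * z) (shiftBy-below m 1ₛ (ℕ.<-≤-trans k<K K≤m))) (ℤ.+-identityʳ _)

  truncated-*ₛ-commutativeMonoid : ℕ → CommutativeMonoid 0ℓ 0ℓ
  truncated-*ₛ-commutativeMonoid K = record
    { Carrier = Series
    ; _≈_ = _≈[ K ]_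
    ; _∙_ = _*ₛ_
    ; ε = 1ₛ
    ; isCommutativeMonoid = record
      { isMonoid = record
        { isSemigroup = record
          { isMagma = record
            { isEquivalence = record
              { refl = λ _ _ → refl
              ; sym = λ f≈g i i<K → sym (f≈g i i<K)
              ; trans = λ f≈g g≈h i i<K → trans (f≈g i i<K) (g≈h i i<K) }
            ; ∙-cong = λ f≈ g≈ i i<K →
                *ₛ-cong-upTo i (λ j j≤i → f≈ j (ℕ.≤-<-trans j≤i i<K)) (λ j j≤i → g≈ j (ℕ.≤-<-trans j≤i i<K)) }
          ; assoc = λ f g h i _ → *ₛ-assoc f g h i }
        ; identity = (λ f i _ → *ₛ-identityˡ f i) , (λ f i _ → *ₛ-identityʳ f i) }
      ; comm = λ f g i _ → *ₛ-comm f g i } }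

  ConstantOne : Series → Set
  ConstantOne f = f 0 ≡ 1ℤ

  *ₛ-constantOne : ∀ {f g} → ConstantOne f → ConstantOne g → ConstantOne (f *ₛ g)
  *ₛ-constantOne f₀≡1 g₀≡1 = cong₂ _*_ f₀≡1 g₀≡1

  if-constantOne : ∀ b {f g} → ConstantOne f → ConstantOne g → ConstantOne (if b then f else g)
  if-constantOne true f₀≡1 _ = f₀≡1
  if-constantOne false _ g₀≡1 = g₀≡1

  *ₛ-cancelˡ : ∀ {D X Y K} → ConstantOne D → D *ₛ X ≈[ K ] D *ₛ Y → X ≈[ K ] Y
  *ₛ-cancelˡ {D} {X} {Y} {K} D₀≡1 DX≈DY = agreeBelow K ℕ.≤-refl
    where
    open GroupProperties (AbelianGroup.group ℤ.+-0-abelianGroup) using (∙-cancelʳ)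

    leading : ∀ Z k → (D *ₛ Z) (suc k) ≡ Z (suc k) + (D ∘ suc *ₛ Z) k
    leading Z k = trans (cong (λ d → d * Z (suc k) + (D ∘ suc *ₛ Z) k) D₀≡1)
      (cong (_+ (D ∘ suc *ₛ Z) k) (ℤ.*-identityˡ (Z (suc k))))

    next : ∀ k → X ≈[ k ] Y → k ℕ.< K → X k ≡ Y k
    next zero _ 0<K = begin
      X 0            ≡⟨ ℤ.*-identityˡ (X 0) ⟨
      1ℤ * X 0       ≡⟨ cong (_* X 0) D₀≡1 ⟨
      (D *ₛ X) 0     ≡⟨ DX≈DY 0 0<K ⟩
      (D *ₛ Y) 0     ≡⟨ cong (_* Y 0) D₀≡1 ⟩
      1ℤ * Y 0       ≡⟨ ℤ.*-identityˡ (Y 0) ⟩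
      Y 0            ∎
    next (suc k) X≈Y k<K = ∙-cancelʳ ((D ∘ suc *ₛ X) k) (X (suc k)) (Y (suc k)) (begin
      X (suc k) + (D ∘ suc *ₛ X) k   ≡⟨ leading X k ⟨
      (D *ₛ X) (suc k)               ≡⟨ DX≈DY (suc k) k<K ⟩
      (D *ₛ Y) (suc k)               ≡⟨ leading Y k ⟩
      Y (suc k) + (D ∘ suc *ₛ Y) k   ≡⟨ cong (Y (suc k) +_) tails ⟨
      Y (suc k) + (D ∘ suc *ₛ X) k   ∎)
      where
      tails : (D ∘ suc *ₛ X) k ≡ (D ∘ suc *ₛ Y) k
      tails = *ₛ-cong-upTo k (λ _ _ → refl) (λ j j≤k → X≈Y j (s≤s j≤k))

    agreeBelow : ∀ n → n ℕ.≤ K → X ≈[ n ] Y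
    agreeBelow zero _ i ()
    agreeBelow (suc n) n<K = ≈[]-extend X≈Y (next n X≈Y n<K)
      where X≈Y = agreeBelow n (ℕ.<⇒≤ n<K)

  *ₛ-congˡ-≈[] : ∀ {K} f {g g′} → g ≈[ K ] g′ → f *ₛ g ≈[ K ] f *ₛ g′
  *ₛ-congˡ-≈[] {K} f = CommutativeMonoid.∙-congˡ (truncated-*ₛ-commutativeMonoid K) {f}

module PolynomialSeries where

  open Arithmetic using (-1^-odd)
  open PowerSeries
  open import Data.Bool using (Bool; true; false)
  open import Data.Nat.Divisibility using (_∤_)
  open import Data.Nat as ℕ using (ℕ; zero; suc; z≤n; s≤s; _⊔_)
  import Data.Nat.Properties as ℕ
  open import Data.Integer using (ℤ; 0ℤ; 1ℤ; -1ℤ; -_; _+_; _-_; _*_; _^_)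
  import Data.Integer.Properties as ℤ
  open import Data.Integer.Solver using (module +-*-Solver)
  open import Data.List using ([]; _∷_; _++_; reverse; length; map)
  open import Data.Product using (_,_)
  import Data.List.Properties as List
  open import Function using (_∘_)
  open import Relation.Nullary using (yes; no)
  open import Relation.Binary.PropositionalEquality
  open +-*-Solver using (solve; _:+_; _:-_; _:*_; :-_; _:=_; con)
  open ≡-Reasoning

  coeff-+ₚ : ∀ p q → coeff (p +ₚ q) ≗ coeff p +ₛ coeff q
  coeff-+ₚ [] q k = sym (ℤ.+-identityˡ _)
  coeff-+ₚ (a ∷ p) [] k = sym (ℤ.+-identityʳ _)
  coeff-+ₚ (a ∷ p) (b ∷ q) zero = refl
  coeff-+ₚ (a ∷ p) (b ∷ q) (suc k) = coeff-+ₚ p q k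

  coeff-map-* : ∀ a q → coeff (map (a *_) q) ≗ a ·ₛ coeff q
  coeff-map-* a [] k = sym (ℤ.*-zeroʳ a)
  coeff-map-* a (b ∷ q) zero = refl
  coeff-map-* a (b ∷ q) (suc k) = coeff-map-* a q k

  coeff-*ₚ : ∀ p q → coeff (p *ₚ q) ≗ coeff p *ₛ coeff q
  coeff-*ₚ [] q k = sym (*ₛ-zeroˡ (coeff q) (λ _ → refl) k)
  coeff-*ₚ (a ∷ p) q zero = begin
    coeff (map (a *_) q +ₚ (0ℤ ∷ p *ₚ q)) 0   ≡⟨ coeff-+ₚ (map (a *_) q) (0ℤ ∷ p *ₚ q) 0 ⟩
    coeff (map (a *_) q) 0 + 0ℤ               ≡⟨ ℤ.+-identityʳ _ ⟩
    coeff (map (a *_) q) 0                    ≡⟨ coeff-map-* a q 0 ⟩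
    a * coeff q 0                             ∎
  coeff-*ₚ (a ∷ p) q (suc k) = trans (coeff-+ₚ (map (a *_) q) (0ℤ ∷ p *ₚ q) (suc k))
    (cong₂ _+_ (coeff-map-* a q (suc k)) (coeff-*ₚ p q k))

  coeff-∷ : ∀ a xs → coeff (a ∷ xs) ≗ a ·ₛ 1ₛ +ₛ shift (coeff xs)
  coeff-∷ a xs zero = sym (trans (ℤ.+-identityʳ _) (ℤ.*-identityʳ a))
  coeff-∷ a xs (suc k) = sym (trans (cong (_+ coeff xs k) (ℤ.*-zeroʳ a)) (ℤ.+-identityˡ _))

  coeff-++ : ∀ ys zs → coeff (ys ++ zs) ≗ coeff ys +ₛ shiftBy (length ys) (coeff zs)
  coeff-++ [] zs k = sym (ℤ.+-identityˡ _)
  coeff-++ (y ∷ ys) zs zero = sym (ℤ.+-identityʳ y)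
  coeff-++ (y ∷ ys) zs (suc k) = coeff-++ ys zs k

  coeff-[_] : ∀ a → coeff (a ∷ []) ≗ a ·ₛ 1ₛ
  coeff-[ a ] zero = sym (ℤ.*-identityʳ a)
  coeff-[ a ] (suc k) = sym (ℤ.*-zeroʳ a)

  SupportedBelow : ℕ → Series → Set
  SupportedBelow N f = ∀ i → N ℕ.≤ i → f i ≡ 0ℤ

  coeff-supportedBelow-length : ∀ xs → SupportedBelow (length xs) (coeff xs)
  coeff-supportedBelow-length [] i _ = refl
  coeff-supportedBelow-length (x ∷ xs) (suc i) (s≤s le) = coeff-supportedBelow-length xs i le

  coeff-≈[length]⇒≗ : ∀ {xs ys L} → length xs ≡ L → length ys ≡ L → coeff xs ≈[ L ] coeff ys → coeff xs ≗ coeff ys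
  coeff-≈[length]⇒≗ {xs} {ys} {L} refl ys≡L xs≈ys i with i ℕ.<? L
  ... | yes i<L = xs≈ys i i<L
  ... | no i≮L = trans (coeff-supportedBelow-length xs i (ℕ.≮⇒≥ i≮L))
    (sym (coeff-supportedBelow-length ys i (subst (ℕ._≤ i) (sym ys≡L) (ℕ.≮⇒≥ i≮L))))

  -- reversal N f lists f (N - 1), …, f 0: the reciprocal of a polynomial of degree < N.
  reversal : ℕ → Series → Series
  reversal zero f k = 0ℤ
  reversal (suc N) f zero = f N
  reversal (suc N) f (suc k) = reversal N f k

  reversal-cong : ∀ N {f g} → f ≗ g → reversal N f ≗ reversal N g
  reversal-cong zero f≗g k = refl
  reversal-cong (suc N) f≗g zero = f≗g N
  reversal-cong (suc N) f≗g (suc k) = reversal-cong N f≗g k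

  reversal-+ₛ : ∀ N f g → reversal N (f +ₛ g) ≗ reversal N f +ₛ reversal N g
  reversal-+ₛ zero f g k = refl
  reversal-+ₛ (suc N) f g zero = refl
  reversal-+ₛ (suc N) f g (suc k) = reversal-+ₛ N f g k

  reversal-·ₛ : ∀ N c f → reversal N (c ·ₛ f) ≗ c ·ₛ reversal N f
  reversal-·ₛ zero c f k = sym (ℤ.*-zeroʳ c)
  reversal-·ₛ (suc N) c f zero = refl
  reversal-·ₛ (suc N) c f (suc k) = reversal-·ₛ N c f k

  reversal-shift : ∀ N f → reversal (suc N) (shift f) ≗ reversal N f
  reversal-shift zero f zero = refl
  reversal-shift zero f (suc k) = refl
  reversal-shift (suc N) f zero = refl
  reversal-shift (suc N) f (suc k) = reversal-shift N f k

  reversal-zero : ∀ N {f} → IsZero f → IsZero (reversal N f)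
  reversal-zero zero f≡0 k = refl
  reversal-zero (suc N) f≡0 zero = f≡0 N
  reversal-zero (suc N) f≡0 (suc k) = reversal-zero N f≡0 k

  reversal-+ : ∀ d N f → SupportedBelow N f → reversal (d ℕ.+ N) f ≗ shiftBy d (reversal N f)
  reversal-+ zero N f f<N k = refl
  reversal-+ (suc d) N f f<N zero = f<N (d ℕ.+ N) (ℕ.m≤n+m N d)
  reversal-+ (suc d) N f f<N (suc k) = reversal-+ d N f f<N k

  reversal-suc : ∀ N f → reversal (suc N) f ≗ reversal N (f ∘ suc) +ₛ f 0 ·ₛ y^ N
  reversal-suc zero f zero = sym (trans (ℤ.+-identityˡ _) (ℤ.*-identityʳ (f 0)))
  reversal-suc zero f (suc k) = sym (trans (ℤ.+-identityˡ _) (ℤ.*-zeroʳ (f 0)))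
  reversal-suc (suc N) f zero = sym (trans (cong (f (suc N) +_) (ℤ.*-zeroʳ (f 0))) (ℤ.+-identityʳ _))
  reversal-suc (suc N) f (suc k) = reversal-suc N f k

  reversal-+ˡ : ∀ k j f → reversal (suc (k ℕ.+ j)) f j ≡ f k
  reversal-+ˡ k zero f = cong f (ℕ.+-identityʳ k)
  reversal-+ˡ k (suc j) f = trans (cong (λ n → reversal (suc n) f (suc j)) (ℕ.+-suc k j)) (reversal-+ˡ k j f)

  reversal-*ₛ : ∀ a b f g → SupportedBelow a f → SupportedBelow (suc b) g →
    reversal (a ℕ.+ b) (f *ₛ g) ≗ reversal a f *ₛ reversal (suc b) g
  reversal-*ₛ zero b f g f<0 g<b k = begin
    reversal b (f *ₛ g) k      ≡⟨ reversal-zero b (*ₛ-zeroˡ g (λ i → f<0 i z≤n)) k ⟩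
    0ℤ                         ≡⟨ *ₛ-zeroˡ (reversal (suc b) g) (λ _ → refl) k ⟨
    (reversal 0 f *ₛ G) k      ∎
    where G = reversal (suc b) g
  reversal-*ₛ (suc a) b f g f<a g<b k = begin
    reversal (suc a ℕ.+ b) (f *ₛ g) k
      ≡⟨ reversal-cong (suc a ℕ.+ b) (*ₛ-unfoldˡ f g) k ⟩
    reversal (suc (a ℕ.+ b)) (f 0 ·ₛ g +ₛ shift (f ∘ suc *ₛ g)) k
      ≡⟨ reversal-+ₛ (suc (a ℕ.+ b)) (f 0 ·ₛ g) (shift (f ∘ suc *ₛ g)) k ⟩
    reversal (suc (a ℕ.+ b)) (f 0 ·ₛ g) k + reversal (suc (a ℕ.+ b)) (shift (f ∘ suc *ₛ g)) k
      ≡⟨ cong₂ _+_ head tail ⟩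
    (f 0 ·ₛ y^ a *ₛ G) k + (reversal a (f ∘ suc) *ₛ G) k
      ≡⟨ *ₛ-distribʳ-+ₛ (f 0 ·ₛ y^ a) (reversal a (f ∘ suc)) G k ⟨
    ((f 0 ·ₛ y^ a +ₛ reversal a (f ∘ suc)) *ₛ G) k
      ≡⟨ *ₛ-cong (λ i → trans (ℤ.+-comm ((f 0 ·ₛ y^ a) i) _) (sym (reversal-suc a f i))) (λ _ → refl) k ⟩
    (reversal (suc a) f *ₛ G) k
      ∎
    where
    G = reversal (suc b) g
    head : reversal (suc (a ℕ.+ b)) (f 0 ·ₛ g) k ≡ (f 0 ·ₛ y^ a *ₛ G) k
    head = begin
      reversal (suc (a ℕ.+ b)) (f 0 ·ₛ g) k   ≡⟨ reversal-·ₛ (suc (a ℕ.+ b)) (f 0) g k ⟩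
      f 0 * reversal (suc (a ℕ.+ b)) g k      ≡⟨ cong (λ n → f 0 * reversal n g k) (ℕ.+-suc a b) ⟨
      f 0 * reversal (a ℕ.+ suc b) g k        ≡⟨ cong (f 0 *_) (reversal-+ a (suc b) g g<b k) ⟩
      f 0 * shiftBy a G k                     ≡⟨ cong (f 0 *_) (*ₛ-y^ˡ a G k) ⟨
      f 0 * (y^ a *ₛ G) k                     ≡⟨ *ₛ-·ₛ-assoc (f 0) (y^ a) G k ⟨
      (f 0 ·ₛ y^ a *ₛ G) k                    ∎
    tail : reversal (suc (a ℕ.+ b)) (shift (f ∘ suc *ₛ g)) k ≡ (reversal a (f ∘ suc) *ₛ G) k
    tail = trans (reversal-shift (a ℕ.+ b) (f ∘ suc *ₛ g) k)
             (reversal-*ₛ a b (f ∘ suc) g (λ i a≤i → f<a (suc i) (s≤s a≤i)) g<b k)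

  coeff-reverse : ∀ xs → coeff (reverse xs) ≗ reversal (length xs) (coeff xs)
  coeff-reverse [] k = refl
  coeff-reverse (a ∷ xs) k = begin
    coeff (reverse (a ∷ xs)) k
      ≡⟨ cong (λ zs → coeff zs k) (List.unfold-reverse a xs) ⟩
    coeff (reverse xs ++ a ∷ []) k
      ≡⟨ coeff-++ (reverse xs) (a ∷ []) k ⟩
    coeff (reverse xs) k + shiftBy (length (reverse xs)) (coeff (a ∷ [])) k
      ≡⟨ cong₂ _+_ (coeff-reverse xs k) (cong (λ n → shiftBy n (coeff (a ∷ [])) k) (List.length-reverse xs)) ⟩
    reversal (length xs) (coeff xs) k + shiftBy (length xs) (coeff (a ∷ [])) k
      ≡⟨ cong (reversal (length xs) (coeff xs) k +_)
           (trans (shiftBy-cong (length xs) coeff-[ a ] k) (shiftBy-·ₛ (length xs) a 1ₛ k)) ⟩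
    reversal (length xs) (coeff xs) k + (a ·ₛ y^ (length xs)) k
      ≡⟨ reversal-suc (length xs) (coeff (a ∷ xs)) k ⟨
    reversal (length (a ∷ xs)) (coeff (a ∷ xs)) k
      ∎

  reverse-isCoefficient : ∀ xs k → k ℕ.< length xs → IsCoefficientOf (coeff (reverse xs) k) xs
  reverse-isCoefficient xs k k<len = j , ℕ.≤-trans (s≤s (ℕ.m∸n≤m (length xs ℕ.∸ 1) k)) (ℕ.≤-reflexive len≡) , (begin
    coeff xs j                                      ≡⟨ cong (λ zs → coeff zs j) (List.reverse-involutive xs) ⟨
    coeff (reverse (reverse xs)) j                  ≡⟨ coeff-reverse (reverse xs) j ⟩
    reversal (length (reverse xs)) (coeff (reverse xs)) j ≡⟨ cong (λ n → reversal n (coeff (reverse xs)) j) len≡′ ⟩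
    reversal (suc (k ℕ.+ j)) (coeff (reverse xs)) j ≡⟨ reversal-+ˡ k j (coeff (reverse xs)) ⟩
    coeff (reverse xs) k                            ∎)
    where
    j = length xs ℕ.∸ 1 ℕ.∸ k
    len≡ : suc (length xs ℕ.∸ 1) ≡ length xs
    len≡ = ℕ.suc-pred (length xs) {{ℕ.>-nonZero (ℕ.≤-trans (s≤s z≤n) k<len)}}
    len≡′ : length (reverse xs) ≡ suc (k ℕ.+ j)
    len≡′ = trans (List.length-reverse xs) (trans (sym len≡) (cong suc (sym (ℕ.m+[n∸m]≡n (ℕ.≤-pred (subst (k ℕ.<_) (sym len≡) k<len))))))

  length-+ₚ : ∀ p q → length (p +ₚ q) ≡ length p ⊔ length q
  length-+ₚ [] q = refl
  length-+ₚ (a ∷ p) [] = sym (ℕ.⊔-identityʳ _)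
  length-+ₚ (a ∷ p) (b ∷ q) = cong suc (length-+ₚ p q)

  length-*ₚ-∷ : ∀ a p b q → length ((a ∷ p) *ₚ (b ∷ q)) ≡ suc (length p ℕ.+ length q)
  length-*ₚ-∷ a [] b q = cong suc (trans (length-+ₚ (map (a *_) q) [])
    (trans (ℕ.⊔-identityʳ _) (List.length-map (a *_) q)))
  length-*ₚ-∷ a (a′ ∷ p) b q = cong suc (trans (length-+ₚ (map (a *_) q) ((a′ ∷ p) *ₚ (b ∷ q)))
    (trans (cong₂ _⊔_ (List.length-map (a *_) q) (length-*ₚ-∷ a′ p b q))
      (ℕ.m≤n⇒m⊔n≡n (ℕ.m≤n⇒m≤1+n (ℕ.m≤n+m (length q) (length p))))))

  data NonEmpty : Poly → Set where
    nonEmpty : ∀ {a p} → NonEmpty (a ∷ p)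

  degree : Poly → ℕ
  degree p = length p ℕ.∸ 1

  *ₚ-nonEmpty : ∀ {p q} → NonEmpty p → NonEmpty q → NonEmpty (p *ₚ q)
  *ₚ-nonEmpty nonEmpty nonEmpty = nonEmpty

  length-*ₚ : ∀ {p q} → NonEmpty p → NonEmpty q → length (p *ₚ q) ≡ degree p ℕ.+ length q
  length-*ₚ {a ∷ p} {b ∷ q} nonEmpty nonEmpty = trans (length-*ₚ-∷ a p b q) (sym (ℕ.+-suc (length p) (length q)))

  coeff-reverse-*ₚ : ∀ {p q} → NonEmpty p → NonEmpty q → coeff (reverse (p *ₚ q)) ≗ coeff (reverse p) *ₛ coeff (reverse q)
  coeff-reverse-*ₚ {p@(a ∷ p′)} {q@(b ∷ q′)} nonEmpty nonEmpty k = begin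
    coeff (reverse (p *ₚ q)) k
      ≡⟨ coeff-reverse (p *ₚ q) k ⟩
    reversal (length (p *ₚ q)) (coeff (p *ₚ q)) k
      ≡⟨ cong (λ n → reversal n (coeff (p *ₚ q)) k) (length-*ₚ-∷ a p′ b q′) ⟩
    reversal (length p ℕ.+ degree q) (coeff (p *ₚ q)) k
      ≡⟨ reversal-cong (length p ℕ.+ degree q) (coeff-*ₚ p q) k ⟩
    reversal (length p ℕ.+ degree q) (coeff p *ₛ coeff q) k
      ≡⟨ reversal-*ₛ (length p) (degree q) (coeff p) (coeff q)
           (coeff-supportedBelow-length p) (coeff-supportedBelow-length q) k ⟩
    (reversal (length p) (coeff p) *ₛ reversal (length q) (coeff q)) k
      ≡⟨ *ₛ-cong (coeff-reverse p) (coeff-reverse q) k ⟨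
    (coeff (reverse p) *ₛ coeff (reverse q)) k
      ∎

  coeff-subPrefix : ∀ f h k → coeff (subPrefix f h) k ≡ coeff f k - coeff h k
  coeff-subPrefix f [] k = sym (ℤ.+-identityʳ _)
  coeff-subPrefix [] (b ∷ h) zero = sym (ℤ.+-identityˡ _)
  coeff-subPrefix [] (b ∷ h) (suc k) = coeff-subPrefix [] h k
  coeff-subPrefix (a ∷ f) (b ∷ h) zero = refl
  coeff-subPrefix (a ∷ f) (b ∷ h) (suc k) = coeff-subPrefix f h k

  length-subPrefix : ∀ f h → length f ℕ.≤ length (subPrefix f h)
  length-subPrefix f [] = ℕ.≤-refl
  length-subPrefix [] (b ∷ h) = z≤n
  length-subPrefix (a ∷ f) (b ∷ h) = s≤s (length-subPrefix f h)

  length-quotRev : ∀ k f g → k ℕ.≤ length f → length (quotRev k f g) ≡ k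
  length-quotRev zero f g _ = refl
  length-quotRev (suc k) (c ∷ f) g (s≤s k≤f) =
    cong suc (length-quotRev k _ g (ℕ.≤-trans k≤f (length-subPrefix f (map (c *_) g))))

  -- Each step of the division cancels the current leading coefficient of the dividend.
  quotRev-*ₛ : ∀ k f g → k ℕ.≤ length f → coeff (quotRev k f g) *ₛ coeff (1ℤ ∷ g) ≈[ k ] coeff f
  quotRev-*ₛ (suc k) (c ∷ f) g _ zero _ = ℤ.*-identityʳ c
  quotRev-*ₛ (suc k) (c ∷ f) g (s≤s k≤f) (suc i) (s≤s i<k) = begin
    c * coeff g i + (coeff (quotRev k F g) *ₛ coeff (1ℤ ∷ g)) i
      ≡⟨ cong ((c * coeff g i) +_) (quotRev-*ₛ k F g (ℕ.≤-trans k≤f (length-subPrefix f (map (c *_) g))) i i<k) ⟩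
    c * coeff g i + coeff F i
      ≡⟨ cong ((c * coeff g i) +_) (trans (coeff-subPrefix f (map (c *_) g) i) (cong (λ z → coeff f i - z) (coeff-map-* c g i))) ⟩
    c * coeff g i + (coeff f i - c * coeff g i)
      ≡⟨ solve 2 (λ x y → x :+ (y :- x) := y) refl (c * coeff g i) (coeff f i) ⟩
    coeff f i
      ∎
    where F = subPrefix f (map (c *_) g)

  geometric : ℤ → ℕ → Poly
  geometric c zero = []
  geometric c (suc n) = 1ℤ ∷ map (c *_) (geometric c n)

  length-geometric : ∀ c n → length (geometric c n) ≡ n
  length-geometric c zero = refl
  length-geometric c (suc n) = cong suc (trans (List.length-map (c *_) (geometric c n)) (length-geometric c n))

  1-cy*geometric : ∀ c n → (1ₛ +ₛ (- c) ·ₛ y^ 1) *ₛ coeff (geometric c n) ≗ 1ₛ +ₛ (- c ^ n) ·ₛ y^ n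
  1-cy*geometric c zero k = begin
    (D *ₛ coeff []) k            ≡⟨ *ₛ-zeroʳ D (λ _ → refl) k ⟩
    0ℤ                           ≡⟨ solve 1 (λ a → con 0ℤ := a :+ (:- con 1ℤ) :* a) refl (1ₛ k) ⟩
    1ₛ k + (- 1ℤ) * 1ₛ k         ∎
    where
    D = 1ₛ +ₛ (- c) ·ₛ y^ 1
  1-cy*geometric c (suc n) k = begin
    (D *ₛ coeff (1ℤ ∷ map (c *_) G)) k
      ≡⟨ *ₛ-cong (λ _ → refl) (λ i → trans (coeff-∷ 1ℤ (map (c *_) G) i)
           (cong₂ _+_ (ℤ.*-identityˡ (1ₛ i)) (shift-cong (coeff-map-* c G) i))) k ⟩
    (D *ₛ (1ₛ +ₛ shift (c ·ₛ coeff G))) k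
      ≡⟨ *ₛ-distribˡ-+ₛ D 1ₛ (shift (c ·ₛ coeff G)) k ⟩
    (D *ₛ 1ₛ) k + (D *ₛ shift (c ·ₛ coeff G)) k
      ≡⟨ cong₂ _+_ (*ₛ-identityʳ D k) (trans (*ₛ-shiftʳ D (c ·ₛ coeff G) k)
           (shift-cong (λ i → trans (*ₛ-comm D (c ·ₛ coeff G) i) (trans (*ₛ-·ₛ-assoc c (coeff G) D i)
             (cong (c *_) (trans (*ₛ-comm (coeff G) D i) (1-cy*geometric c n i))))) k)) ⟩
    D k + shift (c ·ₛ (1ₛ +ₛ (- c ^ n) ·ₛ y^ n)) k
      ≡⟨ pointwise k ⟩
    (1ₛ +ₛ (- c ^ suc n) ·ₛ y^ (suc n)) k
      ∎
    where
    D = 1ₛ +ₛ (- c) ·ₛ y^ 1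
    G = geometric c n
    pointwise : ∀ k → D k + shift (c ·ₛ (1ₛ +ₛ (- c ^ n) ·ₛ y^ n)) k ≡ (1ₛ +ₛ (- c ^ suc n) ·ₛ y^ (suc n)) k
    pointwise zero = solve 2 (λ c d → (con 1ℤ :+ (:- c) :* con 0ℤ) :+ con 0ℤ := con 1ℤ :+ (:- (c :* d)) :* con 0ℤ) refl c (c ^ n)
    pointwise (suc k) = solve 4 (λ c d a b → (con 0ℤ :+ (:- c) :* a) :+ c :* (a :+ (:- d) :* b) := con 0ℤ :+ (:- (c :* d)) :* b)
      refl c (c ^ n) (1ₛ k) (y^ n k)

  -- The reciprocal of Φ_{2d} is that of Φ_d at -y, and 1 - (-y)ⁿ = 1 + yⁿ for odd n.
  1∓y^ : Bool → ℕ → Series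
  1∓y^ false n = 1-y^ n
  1∓y^ true n = 1+y^ n

  signOf : Bool → ℤ
  signOf false = 1ℤ
  signOf true = -1ℤ

  1∓y^≗1-signOf·y : ∀ e → 1∓y^ e 1 ≗ 1ₛ +ₛ (- signOf e) ·ₛ y^ 1
  1∓y^≗1-signOf·y false k = refl
  1∓y^≗1-signOf·y true k = cong (λ z → 1ₛ k + z) (sym (ℤ.*-identityˡ (y^ 1 k)))

  1∓y^*geometric : ∀ e n → 2 ∤ n → 1∓y^ e 1 *ₛ coeff (geometric (signOf e) n) ≗ 1∓y^ e n
  1∓y^*geometric e n 2∤n k = begin
    (1∓y^ e 1 *ₛ coeff (geometric (signOf e) n)) k                       ≡⟨ *ₛ-cong (1∓y^≗1-signOf·y e) (λ _ → refl) k ⟩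
    ((1ₛ +ₛ (- signOf e) ·ₛ y^ 1) *ₛ coeff (geometric (signOf e) n)) k   ≡⟨ 1-cy*geometric (signOf e) n k ⟩
    1ₛ k + (- signOf e ^ n) * y^ n k                                     ≡⟨ power e ⟩
    1∓y^ e n k                                                           ∎
    where
    open ≡-Reasoning
    power : ∀ e → 1ₛ k + (- signOf e ^ n) * y^ n k ≡ 1∓y^ e n k
    power false = cong (λ c → 1ₛ k + (- c) * y^ n k) (ℤ.^-zeroˡ n)
    power true = trans (cong (λ c → 1ₛ k + (- c) * y^ n k) (-1^-odd n 2∤n)) (cong (λ z → 1ₛ k + z) (ℤ.*-identityˡ (y^ n k)))

  linear : Bool → Poly
  linear e = 1ℤ ∷ - signOf e ∷ []

  coeff-linear : ∀ e → coeff (linear e) ≗ 1∓y^ e 1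
  coeff-linear false zero = refl
  coeff-linear false (suc zero) = refl
  coeff-linear false (suc (suc k)) = refl
  coeff-linear true zero = refl
  coeff-linear true (suc zero) = refl
  coeff-linear true (suc (suc k)) = refl

  1∓y^-constantOne : ∀ e n → 1 ≤ n → ConstantOne (1∓y^ e n)
  1∓y^-constantOne false (suc n) _ = refl
  1∓y^-constantOne true (suc n) _ = refl

module BigOperators where

  open Arithmetic using (prime-∤⇒coprime)

  open import Algebra.Bundles using (CommutativeMonoid)
  open import Data.Nat as ℕ using (ℕ; zero; suc; _∸_; z≤n; s≤s; _≤_; _<_)
  import Data.Nat.Properties as ℕ
  open import Data.Nat.Divisibility
  open import Data.Nat.Coprimality using (coprime-divisor)
  open import Data.Nat.Primality using (Prime)
  open import Data.Sum using (inj₁; inj₂)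
  open import Function using (_∘_)
  open import Relation.Nullary using (Dec; yes; no)
  open import Relation.Nullary.Negation using (contradiction)
  open import Relation.Binary.PropositionalEquality as ≡ using (_≡_; _≢_)

  -- They are defined from the bare operation so that they agree definitionally for every
  -- equality on the carrier (power series are compared modulo several powers of y).
  module BigOperator {a} {A : Set a} (_∙_ : A → A → A) (ε : A) where

    infix 25 Π[≤_]_ Π[∣_]_ Π[∣_]′_

    when unless : ∀ {p} {P : Set p} → Dec P → A → A
    when (yes _) x = x
    when (no _) _ = ε
    unless (yes _) _ = ε
    unless (no _) x = x

    Π[≤_]_ : ℕ → (ℕ → A) → A
    Π[≤ zero ] f = ε
    Π[≤ suc n ] f = Π[≤ n ] f ∙ f (suc n)

    divisorsOf : ℕ → (ℕ → A) → ℕ → A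
    divisorsOf m f d = when (d ∣? m) (f d)

    Π[∣_]_ : ℕ → (ℕ → A) → A
    Π[∣ m ] f = Π[≤ m ] divisorsOf m f

    Π[∣_]′_ : ℕ → (ℕ → A) → A
    Π[∣ m ]′ f = Π[≤ m ∸ 1 ] divisorsOf m f

  module BigOperatorProperties {c ℓ} (M : CommutativeMonoid c ℓ) where

    open CommutativeMonoid M renaming (Carrier to A)
    open import Relation.Binary.Reasoning.Setoid setoid
    open import Algebra.Solver.CommutativeMonoid M using (solve; _⊜_; _⊕_)
    open BigOperator _∙_ ε public

    Π-cong : ∀ n {f g} → (∀ d → 1 ≤ d → d ≤ n → f d ≈ g d) → Π[≤ n ] f ≈ Π[≤ n ] g
    Π-cong zero f≈g = refl
    Π-cong (suc n) f≈g =
      ∙-cong (Π-cong n (λ d 1≤d d≤n → f≈g d 1≤d (ℕ.m≤n⇒m≤1+n d≤n))) (f≈g (suc n) (s≤s z≤n) ℕ.≤-refl)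

    Π-identity : ∀ n {f} → (∀ d → 1 ≤ d → d ≤ n → f d ≈ ε) → Π[≤ n ] f ≈ ε
    Π-identity zero f≈ε = refl
    Π-identity (suc n) f≈ε = trans (∙-cong (Π-identity n (λ d 1≤d d≤n → f≈ε d 1≤d (ℕ.m≤n⇒m≤1+n d≤n)))
      (f≈ε (suc n) (s≤s z≤n) ℕ.≤-refl)) (identityˡ ε)

    Π-∙ : ∀ n f g → Π[≤ n ] (λ d → f d ∙ g d) ≈ Π[≤ n ] f ∙ Π[≤ n ] g
    Π-∙ zero f g = sym (identityˡ ε)
    Π-∙ (suc n) f g = trans (∙-congʳ (Π-∙ n f g))
      (solve 4 (λ a b c d → (a ⊕ b) ⊕ (c ⊕ d) ⊜ (a ⊕ c) ⊕ (b ⊕ d)) refl _ _ _ _)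

    Π-+ : ∀ m n f → Π[≤ m ℕ.+ n ] f ≈ Π[≤ m ] f ∙ Π[≤ n ] (f ∘ (m ℕ.+_))
    Π-+ m zero f = ≡.subst (λ k → Π[≤ k ] f ≈ Π[≤ m ] f ∙ ε) (≡.sym (ℕ.+-identityʳ m)) (sym (identityʳ _))
    Π-+ m (suc n) f = ≡.subst (λ k → Π[≤ k ] f ≈ Π[≤ m ] f ∙ Π[≤ suc n ] (f ∘ (m ℕ.+_))) (≡.sym (ℕ.+-suc m n))
      (trans (∙-cong (Π-+ m n f) (reflexive (≡.cong f (≡.sym (ℕ.+-suc m n))))) (assoc _ _ _))

    Π-update : ∀ n i x {f g} → 1 ≤ i → i ≤ n → (∀ j → 1 ≤ j → j ≤ n → j ≢ i → f j ≈ g j) →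
      f i ≈ x ∙ g i → Π[≤ n ] f ≈ x ∙ Π[≤ n ] g
    Π-update zero (suc i) x _ ()
    Π-update (suc n) i x {f} {g} 1≤i i≤n f≈g fi≈xgi with ℕ.m≤n⇒m<n∨m≡n i≤n
    ... | inj₁ (s≤s i≤n′) = begin
      Π[≤ n ] f ∙ f (suc n)
        ≈⟨ ∙-cong (Π-update n i x 1≤i i≤n′ (λ j 1≤j j≤n → f≈g j 1≤j (ℕ.m≤n⇒m≤1+n j≤n)) fi≈xgi)
                  (f≈g (suc n) (s≤s z≤n) ℕ.≤-refl (ℕ.>⇒≢ (s≤s i≤n′))) ⟩
      (x ∙ Π[≤ n ] g) ∙ g (suc n)
        ≈⟨ assoc _ _ _ ⟩
      x ∙ Π[≤ suc n ] g
        ∎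
    ... | inj₂ ≡.refl = begin
      Π[≤ n ] f ∙ f (suc n)
        ≈⟨ ∙-cong (Π-cong n (λ j 1≤j j≤n → f≈g j 1≤j (ℕ.m≤n⇒m≤1+n j≤n) (ℕ.<⇒≢ (s≤s j≤n)))) fi≈xgi ⟩
      Π[≤ n ] g ∙ (x ∙ g (suc n))
        ≈⟨ solve 3 (λ a b c → a ⊕ (b ⊕ c) ⊜ b ⊕ (a ⊕ c)) refl _ _ _ ⟩
      x ∙ Π[≤ suc n ] g
        ∎

    unless∙when : ∀ {p} {P : Set p} (P? : Dec P) x → unless P? x ∙ when P? x ≈ x
    unless∙when (yes _) x = identityˡ x
    unless∙when (no _) x = identityʳ x

    divisorsOf-self : ∀ m f → divisorsOf m f m ≈ f m
    divisorsOf-self m f with m ∣? m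
    ... | yes _ = refl
    ... | no m∤m = contradiction ∣-refl m∤m

    Π[∣]-cong : ∀ m {f g} → (∀ d → d ∣ m → f d ≈ g d) → Π[∣ m ] f ≈ Π[∣ m ] g
    Π[∣]-cong m {f} {g} f≈g = Π-cong m (λ d _ _ → pointwise d)
      where
      pointwise : ∀ d → divisorsOf m f d ≈ divisorsOf m g d
      pointwise d with d ∣? m
      ... | yes d∣m = f≈g d d∣m
      ... | no _ = refl

    Π[∣]′-cong : ∀ m {f g} → (∀ d → 1 ≤ d → d < m → d ∣ m → f d ≈ g d) → Π[∣ m ]′ f ≈ Π[∣ m ]′ g
    Π[∣]′-cong zero _ = refl
    Π[∣]′-cong (suc m) {f} {g} f≈g = Π-cong m (λ d 1≤d d≤m → pointwise d 1≤d d≤m)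
      where
      pointwise : ∀ d → 1 ≤ d → d ≤ m → divisorsOf (suc m) f d ≈ divisorsOf (suc m) g d
      pointwise d 1≤d d≤m with d ∣? suc m
      ... | yes d∣m = f≈g d 1≤d (s≤s d≤m) d∣m
      ... | no _ = refl

    Π-divisorsOf-∙ : ∀ m n f g → Π[≤ n ] divisorsOf m (λ d → f d ∙ g d) ≈ Π[≤ n ] divisorsOf m f ∙ Π[≤ n ] divisorsOf m g
    Π-divisorsOf-∙ m n f g = trans (Π-cong n (λ d _ _ → pointwise d)) (Π-∙ n (divisorsOf m f) (divisorsOf m g))
      where
      pointwise : ∀ d → divisorsOf m (λ d → f d ∙ g d) d ≈ divisorsOf m f d ∙ divisorsOf m g d
      pointwise d with d ∣? m
      ... | yes _ = refl
      ... | no _ = sym (identityˡ ε)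

    Π[∣]-∙ : ∀ m f g → Π[∣ m ] (λ d → f d ∙ g d) ≈ Π[∣ m ] f ∙ Π[∣ m ] g
    Π[∣]-∙ m = Π-divisorsOf-∙ m m

    Π[∣]′-∙ : ∀ m f g → Π[∣ m ]′ (λ d → f d ∙ g d) ≈ Π[∣ m ]′ f ∙ Π[∣ m ]′ g
    Π[∣]′-∙ m = Π-divisorsOf-∙ m (m ∸ 1)

    Π[∣]-last : ∀ m f → Π[∣ suc m ] f ≈ Π[∣ suc m ]′ f ∙ f (suc m)
    Π[∣]-last m f = ∙-congˡ (divisorsOf-self (suc m) f)

    Π[∣1] : ∀ f → Π[∣ 1 ] f ≈ f 1
    Π[∣1] f = trans (Π[∣]-last 0 f) (identityˡ _)

    Π[∣2] : ∀ f → Π[∣ 2 ] f ≈ f 1 ∙ f 2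
    Π[∣2] f = trans (Π[∣]-last 1 f) (∙-congʳ (trans (identityˡ _) (divisorsOf-self 1 f)))

    Π-divisorsOf-beyond : ∀ m n f → 1 ≤ m → Π[≤ m ℕ.+ n ] divisorsOf m f ≈ Π[∣ m ] f
    Π-divisorsOf-beyond m n f 1≤m = begin
      Π[≤ m ℕ.+ n ] divisorsOf m f                                   ≈⟨ Π-+ m n (divisorsOf m f) ⟩
      Π[∣ m ] f ∙ Π[≤ n ] (λ j → divisorsOf m f (m ℕ.+ j))           ≈⟨ ∙-congˡ (Π-identity n beyond) ⟩
      Π[∣ m ] f ∙ ε                                                  ≈⟨ identityʳ _ ⟩
      Π[∣ m ] f                                                      ∎
      where
      beyond : ∀ j → 1 ≤ j → j ≤ n → divisorsOf m f (m ℕ.+ j) ≈ ε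
      beyond j 1≤j _ with (m ℕ.+ j) ∣? m
      ... | yes m+j∣m = contradiction (∣⇒≤ {{ℕ.>-nonZero 1≤m}} m+j∣m) (ℕ.<⇒≱ (ℕ.m<m+n m 1≤j))
      ... | no _ = refl

    Π-multiples : ∀ q N (g : ℕ → A) → 1 ≤ q → Π[≤ q ℕ.* N ] (λ d → when (q ∣? d) (g d)) ≈ Π[≤ N ] (λ k → g (q ℕ.* k))
    Π-multiples q zero g _ = reflexive (≡.cong (λ n → Π[≤ n ] (λ d → when (q ∣? d) (g d))) (ℕ.*-zeroʳ q))
    Π-multiples q@(suc q′) (suc N) g _ = begin
      Π[≤ q ℕ.* suc N ] h                           ≡⟨ ≡.cong (λ n → Π[≤ n ] h) q*[1+N]≡q*N+q ⟩
      Π[≤ q ℕ.* N ℕ.+ q ] h                         ≈⟨ Π-+ (q ℕ.* N) q h ⟩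
      Π[≤ q ℕ.* N ] h ∙ Π[≤ q ] (h ∘ (q ℕ.* N ℕ.+_)) ≈⟨ ∙-cong (Π-multiples q N g (s≤s z≤n)) block ⟩
      Π[≤ N ] (λ k → g (q ℕ.* k)) ∙ g (q ℕ.* suc N)  ∎
      where
      h : ℕ → A
      h d = when (q ∣? d) (g d)
      q*[1+N]≡q*N+q : q ℕ.* suc N ≡ q ℕ.* N ℕ.+ q
      q*[1+N]≡q*N+q = ≡.trans (ℕ.*-suc q N) (ℕ.+-comm q (q ℕ.* N))
      between : ∀ j → 1 ≤ j → j ≤ q′ → when (q ∣? (q ℕ.* N ℕ.+ j)) (g (q ℕ.* N ℕ.+ j)) ≈ ε
      between j 1≤j j≤q′ with q ∣? (q ℕ.* N ℕ.+ j)
      ... | yes q∣qN+j = contradiction (∣⇒≤ {{ℕ.>-nonZero 1≤j}} (∣m+n∣m⇒∣n q∣qN+j (m∣m*n N))) (ℕ.<⇒≱ (s≤s j≤q′))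
      ... | no _ = refl
      last : when (q ∣? (q ℕ.* N ℕ.+ q)) (g (q ℕ.* N ℕ.+ q)) ≈ g (q ℕ.* suc N)
      last with q ∣? (q ℕ.* N ℕ.+ q)
      ... | yes _ = reflexive (≡.cong g (≡.sym q*[1+N]≡q*N+q))
      ... | no q∤qN+q = contradiction (∣m∣n⇒∣m+n (m∣m*n N) ∣-refl) q∤qN+q
      block : Π[≤ q ] (h ∘ (q ℕ.* N ℕ.+_)) ≈ g (q ℕ.* suc N)
      block = trans (∙-cong (Π-identity q′ between) last) (identityˡ _)

    -- The divisors of q m are the divisors d of m together with the q d.
    Π[∣]-prime-* : ∀ {q m} f → Prime q → q ∤ m → 1 ≤ m →
      Π[∣ q ℕ.* m ] f ≈ Π[∣ m ] (λ d → f d ∙ f (q ℕ.* d))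
    Π[∣]-prime-* {q@(suc q′)} {m} f q-prime q∤m 1≤m = begin
      Π[≤ q ℕ.* m ] divisorsOf (q ℕ.* m) f
        ≈⟨ trans (Π-cong (q ℕ.* m) (λ d _ _ → sym (unless∙when (q ∣? d) _))) (Π-∙ (q ℕ.* m) coprimePart multiplePart) ⟩
      Π[≤ q ℕ.* m ] coprimePart ∙ Π[≤ q ℕ.* m ] multiplePart
        ≈⟨ ∙-cong (trans (Π-cong (q ℕ.* m) (λ d _ _ → coprimePart≈ d)) (Π-divisorsOf-beyond m (q′ ℕ.* m) f 1≤m))
                  (trans (Π-multiples q m _ (s≤s z≤n)) (Π-cong m (λ k _ _ → multiplePart≈ k))) ⟩
      Π[∣ m ] f ∙ Π[∣ m ] (λ d → f (q ℕ.* d))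
        ≈⟨ Π[∣]-∙ m f (λ d → f (q ℕ.* d)) ⟨
      Π[∣ m ] (λ d → f d ∙ f (q ℕ.* d))
        ∎
      where
      coprimePart multiplePart : ℕ → A
      coprimePart d = unless (q ∣? d) (divisorsOf (q ℕ.* m) f d)
      multiplePart d = when (q ∣? d) (divisorsOf (q ℕ.* m) f d)

      coprimePart≈ : ∀ d → unless (q ∣? d) (when (d ∣? q ℕ.* m) (f d)) ≈ when (d ∣? m) (f d)
      coprimePart≈ d with q ∣? d | d ∣? q ℕ.* m | d ∣? m
      ... | yes q∣d | _ | yes d∣m = contradiction (∣-trans q∣d d∣m) q∤m
      ... | yes _ | _ | no _ = refl
      ... | no _ | yes _ | yes _ = refl
      ... | no _ | no _ | no _ = refl
      ... | no q∤d | yes d∣qm | no d∤m = contradiction (coprime-divisor (prime-∤⇒coprime q-prime q∤d) d∣qm) d∤m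
      ... | no _ | no d∤qm | yes d∣m = contradiction (∣n⇒∣m*n q d∣m) d∤qm

      multiplePart≈ : ∀ k → when (q ℕ.* k ∣? q ℕ.* m) (f (q ℕ.* k)) ≈ when (k ∣? m) (f (q ℕ.* k))
      multiplePart≈ k with q ℕ.* k ∣? q ℕ.* m | k ∣? m
      ... | yes _ | yes _ = refl
      ... | no _ | no _ = refl
      ... | yes qk∣qm | no k∤m = contradiction (*-cancelˡ-∣ q qk∣qm) k∤m
      ... | no qk∤qm | yes k∣m = contradiction (*-monoʳ-∣ q k∣m) qk∤qm

module ReciprocalCyclotomic where

  open PowerSeries
  open PolynomialSeries
  open BigOperators
  open import Data.Bool using (if_then_else_)
  open import Data.Nat as ℕ using (ℕ; zero; suc; _∸_; z≤n; s≤s)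
  import Data.Nat.Properties as ℕ
  open import Data.Nat.Divisibility using (_∣_; _∣?_)
  open import Data.Integer using (ℤ; 0ℤ; 1ℤ; -1ℤ)
  import Data.Integer.Properties as ℤ
  open import Data.List using (List; []; _∷_; _++_; _∷ʳ_; reverse; length; drop; replicate; foldr)
  import Data.List.Properties as List
  open import Data.Product using (Σ; _,_; proj₂)
  open import Function using (_∘_)
  open import Relation.Nullary using (Dec; yes; no; does)
  open import Relation.Binary.PropositionalEquality
  open ≡-Reasoning

  open BigOperator _*ₛ_ 1ₛ
  module ΣN = BigOperator ℕ._+_ 0
  open ΣN using () renaming (divisorsOf to divisorsOfℕ; Π[≤_]_ to Σ[≤_]_; Π[∣_]′_ to Σ[∣_]′_)

  when-constantOne : ∀ {P : Set} (P? : Dec P) {f} → ConstantOne f → ConstantOne (when P? f)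
  when-constantOne (yes _) f₀≡1 = f₀≡1
  when-constantOne (no _) _ = refl

  Π-constantOne : ∀ n {f} → (∀ j → 1 ℕ.≤ j → j ℕ.≤ n → ConstantOne (f j)) → ConstantOne (Π[≤ n ] f)
  Π-constantOne zero _ = refl
  Π-constantOne (suc n) {f} f₀≡1 = *ₛ-constantOne {Π[≤ n ] f} {f (suc n)}
    (Π-constantOne n λ j 1≤j j≤n → f₀≡1 j 1≤j (ℕ.m≤n⇒m≤1+n j≤n)) (f₀≡1 (suc n) (s≤s z≤n) ℕ.≤-refl)

  Φʳ : ℕ → Series
  Φʳ d = coeff (reverse (Φ d))

  reverse-replicate : ∀ {A : Set} k (x : A) → reverse (replicate k x) ≡ replicate k x
  reverse-replicate zero x = refl
  reverse-replicate (suc k) x = begin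
    reverse (x ∷ replicate k x)   ≡⟨ List.unfold-reverse x (replicate k x) ⟩
    reverse (replicate k x) ∷ʳ x  ≡⟨ cong (_∷ʳ x) (reverse-replicate k x) ⟩
    replicate k x ∷ʳ x            ≡⟨ replicate-∷ʳ k ⟩
    x ∷ replicate k x             ∎
    where
    replicate-∷ʳ : ∀ k → replicate k x ∷ʳ x ≡ x ∷ replicate k x
    replicate-∷ʳ zero = refl
    replicate-∷ʳ (suc k) = cong (x ∷_) (replicate-∷ʳ k)

  reverse-xPowMinusOne : ∀ k → reverse (xPowMinusOne (suc k)) ≡ 1ℤ ∷ (replicate k 0ℤ ++ -1ℤ ∷ [])
  reverse-xPowMinusOne k = begin
    reverse (-1ℤ ∷ (replicate k 0ℤ ++ 1ℤ ∷ []))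
      ≡⟨ List.unfold-reverse -1ℤ (replicate k 0ℤ ++ 1ℤ ∷ []) ⟩
    reverse (replicate k 0ℤ ++ 1ℤ ∷ []) ∷ʳ -1ℤ
      ≡⟨ cong (_∷ʳ -1ℤ) (List.reverse-++ (replicate k 0ℤ) (1ℤ ∷ [])) ⟩
    (1ℤ ∷ reverse (replicate k 0ℤ)) ∷ʳ -1ℤ
      ≡⟨ cong (λ zs → (1ℤ ∷ zs) ∷ʳ -1ℤ) (reverse-replicate k 0ℤ) ⟩
    1ℤ ∷ (replicate k 0ℤ ++ -1ℤ ∷ [])
      ∎

  length-xPowMinusOne : ∀ k → length (xPowMinusOne (suc k)) ≡ suc (suc k)
  length-xPowMinusOne k = cong suc (trans (List.length-++ (replicate k 0ℤ))
    (trans (cong (ℕ._+ 1) (List.length-replicate k)) (ℕ.+-comm k 1)))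

  coeff-replicate-0-++ : ∀ k zs → coeff (replicate k 0ℤ ++ zs) ≗ shiftBy k (coeff zs)
  coeff-replicate-0-++ zero zs i = refl
  coeff-replicate-0-++ (suc k) zs zero = refl
  coeff-replicate-0-++ (suc k) zs (suc i) = coeff-replicate-0-++ k zs i

  coeff-reverse-xPowMinusOne : ∀ k → coeff (reverse (xPowMinusOne (suc k))) ≗ 1-y^ (suc k)
  coeff-reverse-xPowMinusOne k i = trans (cong (λ zs → coeff zs i) (reverse-xPowMinusOne k)) (lowerTerms i)
    where
    lowerTerms : ∀ i → coeff (1ℤ ∷ (replicate k 0ℤ ++ -1ℤ ∷ [])) i ≡ 1-y^ (suc k) i
    lowerTerms zero = refl
    lowerTerms (suc i) = begin
      coeff (replicate k 0ℤ ++ -1ℤ ∷ []) i   ≡⟨ coeff-replicate-0-++ k (-1ℤ ∷ []) i ⟩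
      shiftBy k (coeff (-1ℤ ∷ [])) i          ≡⟨ shiftBy-cong k coeff-[ -1ℤ ] i ⟩
      shiftBy k (-1ℤ ·ₛ 1ₛ) i                 ≡⟨ shiftBy-·ₛ k -1ℤ 1ₛ i ⟩
      (-1ℤ ·ₛ y^ k) i                         ≡⟨ ℤ.+-identityˡ _ ⟨
      1-y^ (suc k) (suc i)                    ∎

  prodDivStep : ℕ → Σ ℕ (λ _ → Poly) → Poly → Poly
  prodDivStep m (d , q) acc = if does (d ∣? m) then q *ₚ acc else acc

  prodDiv≡foldr-step : ∀ m xs → prodDiv m xs ≡ foldr (prodDivStep m) (1ℤ ∷ []) xs
  prodDiv≡foldr-step m [] = refl
  prodDiv≡foldr-step m (x ∷ xs) = cong (prodDivStep m x) (prodDiv≡foldr-step m xs)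

  partialProduct : ℕ → ℕ → Poly → Poly
  partialProduct m k acc = foldr (prodDivStep m) acc (cycTable k)

  partialProduct-suc : ∀ m k acc → partialProduct m (suc k) acc ≡ partialProduct m k (prodDivStep m (suc k , Φ (suc k)) acc)
  partialProduct-suc m k acc = List.foldr-++ (prodDivStep m) acc (cycTable k) _

  properDivisorProduct : ℕ → Poly
  properDivisorProduct m = prodDiv m (cycTable (m ∸ 1))

  reverse-Φ : ∀ k → reverse (Φ (suc k)) ≡
    quotRev (suc (length (xPowMinusOne (suc k)) ∸ length (properDivisorProduct (suc k))))
      (reverse (xPowMinusOne (suc k))) (drop 1 (reverse (properDivisorProduct (suc k))))
  reverse-Φ k = List.reverse-involutive _

  reverse-Φ-head : ∀ k → Σ (List ℤ) λ rest → reverse (Φ (suc k)) ≡ 1ℤ ∷ rest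
  reverse-Φ-head k = _ , trans (reverse-Φ k)
    (cong (λ f → quotRev (suc (length (xPowMinusOne (suc k)) ∸ length (properDivisorProduct (suc k)))) f
                          (drop 1 (reverse (properDivisorProduct (suc k)))))
          (reverse-xPowMinusOne k))

  Φʳ-constantOne : ∀ k → ConstantOne (Φʳ (suc k))
  Φʳ-constantOne k = cong (λ zs → coeff zs 0) (proj₂ (reverse-Φ-head k))

  Φ-nonEmpty : ∀ k → NonEmpty (Φ (suc k))
  Φ-nonEmpty k with Φ (suc k) | reverse-Φ-head k
  ... | [] | _ , ()
  ... | _ ∷ _ | _ = nonEmpty

  module _ (m : ℕ) where

    stepWith : ∀ {k} → Dec (suc k ∣ m) → Poly → Poly
    stepWith {k} D acc = if does D then Φ (suc k) *ₚ acc else acc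

    nonEmpty-stepWith : ∀ {k acc} (D : Dec (suc k ∣ m)) → NonEmpty acc → NonEmpty (stepWith D acc)
    nonEmpty-stepWith {k} (yes _) acc≠[] = *ₚ-nonEmpty (Φ-nonEmpty k) acc≠[]
    nonEmpty-stepWith (no _) acc≠[] = acc≠[]

    length-stepWith : ∀ {k acc} (D : Dec (suc k ∣ m)) → NonEmpty acc →
      length (stepWith D acc) ≡ ΣN.when D (degree (Φ (suc k))) ℕ.+ length acc
    length-stepWith {k} (yes _) acc≠[] = length-*ₚ (Φ-nonEmpty k) acc≠[]
    length-stepWith (no _) _ = refl

    coeff-reverse-stepWith : ∀ {k acc} (D : Dec (suc k ∣ m)) → NonEmpty acc →
      coeff (reverse (stepWith D acc)) ≗ when D (Φʳ (suc k)) *ₛ coeff (reverse acc)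
    coeff-reverse-stepWith {k} (yes _) acc≠[] = coeff-reverse-*ₚ (Φ-nonEmpty k) acc≠[]
    coeff-reverse-stepWith (no _) _ i = sym (*ₛ-identityˡ _ i)

    length-partialProduct : ∀ k {acc} → NonEmpty acc →
      length (partialProduct m k acc) ≡ Σ[≤ k ] divisorsOfℕ m (degree ∘ Φ) ℕ.+ length acc
    length-partialProduct zero _ = refl
    length-partialProduct (suc k) {acc} acc≠[] = begin
      length (partialProduct m (suc k) acc)
        ≡⟨ cong length (partialProduct-suc m k acc) ⟩
      length (partialProduct m k (stepWith D acc))
        ≡⟨ length-partialProduct k (nonEmpty-stepWith D acc≠[]) ⟩
      Σ[≤ k ] divisorsOfℕ m (degree ∘ Φ) ℕ.+ length (stepWith D acc)
        ≡⟨ cong (Σ[≤ k ] divisorsOfℕ m (degree ∘ Φ) ℕ.+_) (length-stepWith D acc≠[]) ⟩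
      Σ[≤ k ] divisorsOfℕ m (degree ∘ Φ) ℕ.+ (ΣN.when D (degree (Φ (suc k))) ℕ.+ length acc)
        ≡⟨ ℕ.+-assoc (Σ[≤ k ] divisorsOfℕ m (degree ∘ Φ)) _ _ ⟨
      Σ[≤ suc k ] divisorsOfℕ m (degree ∘ Φ) ℕ.+ length acc
        ∎
      where D = suc k ∣? m

    coeff-reverse-partialProduct : ∀ k {acc} → NonEmpty acc →
      coeff (reverse (partialProduct m k acc)) ≗ Π[≤ k ] divisorsOf m Φʳ *ₛ coeff (reverse acc)
    coeff-reverse-partialProduct zero _ i = sym (*ₛ-identityˡ _ i)
    coeff-reverse-partialProduct (suc k) {acc} acc≠[] i = begin
      coeff (reverse (partialProduct m (suc k) acc)) i
        ≡⟨ cong (λ zs → coeff (reverse zs) i) (partialProduct-suc m k acc) ⟩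
      coeff (reverse (partialProduct m k (stepWith D acc))) i
        ≡⟨ coeff-reverse-partialProduct k (nonEmpty-stepWith D acc≠[]) i ⟩
      (Π[≤ k ] divisorsOf m Φʳ *ₛ coeff (reverse (stepWith D acc))) i
        ≡⟨ *ₛ-cong (λ _ → refl) (coeff-reverse-stepWith D acc≠[]) i ⟩
      (Π[≤ k ] divisorsOf m Φʳ *ₛ (when D (Φʳ (suc k)) *ₛ coeff (reverse acc))) i
        ≡⟨ *ₛ-assoc (Π[≤ k ] divisorsOf m Φʳ) _ _ i ⟨
      (Π[≤ suc k ] divisorsOf m Φʳ *ₛ coeff (reverse acc)) i
        ∎
      where D = suc k ∣? m

  Π-divisorsOf-Φʳ-constantOne : ∀ m n → ConstantOne (Π[≤ n ] divisorsOf m Φʳ)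
  Π-divisorsOf-Φʳ-constantOne m n = Π-constantOne n λ where
    (suc j) _ _ → when-constantOne (suc j ∣? m) (Φʳ-constantOne j)

  module _ (k : ℕ) where

    private
      m = suc k
      P = properDivisorProduct m

    length-properDivisorProduct : length P ≡ suc (Σ[∣ m ]′ (degree ∘ Φ))
    length-properDivisorProduct = trans (cong length (prodDiv≡foldr-step m (cycTable k)))
      (trans (length-partialProduct m k nonEmpty) (ℕ.+-comm _ 1))

    coeff-reverse-properDivisorProduct : coeff (reverse P) ≗ Π[∣ m ]′ Φʳ
    coeff-reverse-properDivisorProduct i = begin
      coeff (reverse P) i
        ≡⟨ cong (λ zs → coeff (reverse zs) i) (prodDiv≡foldr-step m (cycTable k)) ⟩
      coeff (reverse (partialProduct m k (1ℤ ∷ []))) i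
        ≡⟨ coeff-reverse-partialProduct m k nonEmpty i ⟩
      (Π[∣ m ]′ Φʳ *ₛ coeff (1ℤ ∷ [])) i
        ≡⟨ *ₛ-cong (λ _ → refl) coeff-[ 1ℤ ] i ⟩
      (Π[∣ m ]′ Φʳ *ₛ (1ℤ ·ₛ 1ₛ)) i
        ≡⟨ *ₛ-cong (λ _ → refl) (λ j → ℤ.*-identityˡ (1ₛ j)) i ⟩
      (Π[∣ m ]′ Φʳ *ₛ 1ₛ) i
        ≡⟨ *ₛ-identityʳ _ i ⟩
      (Π[∣ m ]′ Φʳ) i
        ∎

    reverse-properDivisorProduct : reverse P ≡ 1ℤ ∷ drop 1 (reverse P)
    reverse-properDivisorProduct = headOne (reverse P) length>0 (trans (coeff-reverse-properDivisorProduct 0) (Π-divisorsOf-Φʳ-constantOne m k))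
      where
      length>0 : 1 ℕ.≤ length (reverse P)
      length>0 = subst (1 ℕ.≤_) (sym (trans (List.length-reverse P) length-properDivisorProduct)) (s≤s z≤n)
      headOne : ∀ xs → 1 ℕ.≤ length xs → coeff xs 0 ≡ 1ℤ → xs ≡ 1ℤ ∷ drop 1 xs
      headOne (x ∷ xs) _ refl = refl

    private
      L = suc (length (xPowMinusOne m) ∸ length P)
      F = reverse (xPowMinusOne m)
      G = drop 1 (reverse P)

      L≡ : L ≡ suc (m ∸ Σ[∣ m ]′ (degree ∘ Φ))
      L≡ = cong suc (cong₂ _∸_ (length-xPowMinusOne k) length-properDivisorProduct)

      L≤length-F : L ℕ.≤ length F
      L≤length-F = subst₂ ℕ._≤_ (sym L≡) (sym (trans (List.length-reverse (xPowMinusOne m)) (length-xPowMinusOne k)))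
        (s≤s (ℕ.m∸n≤m m (Σ[∣ m ]′ (degree ∘ Φ))))

    length-Φ : length (Φ m) ≡ suc (m ∸ Σ[∣ m ]′ (degree ∘ Φ))
    length-Φ = begin
      length (Φ m)               ≡⟨ List.length-reverse (Φ m) ⟨
      length (reverse (Φ m))     ≡⟨ cong length (reverse-Φ k) ⟩
      length (quotRev L F G)     ≡⟨ length-quotRev L F G L≤length-F ⟩
      L                          ≡⟨ L≡ ⟩
      suc (m ∸ Σ[∣ m ]′ (degree ∘ Φ)) ∎

    Φʳ-*ₛ-properDivisors : Φʳ m *ₛ Π[∣ m ]′ Φʳ ≈[ length (Φ m) ] 1-y^ m
    Φʳ-*ₛ-properDivisors i i<len = begin
      (Φʳ m *ₛ Π[∣ m ]′ Φʳ) i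
        ≡⟨ *ₛ-cong (λ j → cong (λ zs → coeff zs j) (reverse-Φ k))
             (λ j → trans (sym (coeff-reverse-properDivisorProduct j))
                          (cong (λ zs → coeff zs j) reverse-properDivisorProduct)) i ⟩
      (coeff (quotRev L F G) *ₛ coeff (1ℤ ∷ G)) i
        ≡⟨ quotRev-*ₛ L F G L≤length-F i (subst (i ℕ.<_) (trans length-Φ (sym L≡)) i<len) ⟩
      coeff F i
        ≡⟨ coeff-reverse-xPowMinusOne k i ⟩
      1-y^ m i
        ∎

module OddPrimes (t : ℕ) (p : ℕ → ℕ)
  (p-prime-odd : ∀ i → 1 ≤ i → i ≤ t → Prime (p i) × ¬ (2 ∣ p i))
  (p-increasing : ∀ i j → 1 ≤ i → i < j → j ≤ t → p i < p j) where

  open Arithmetic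
  open PowerSeries
  open PolynomialSeries
  open BigOperators
  open ReciprocalCyclotomic
  open import Algebra.Bundles using (CommutativeMonoid; CommutativeRing)
  open import Data.Bool using (Bool; true; false; not; if_then_else_; _xor_)
  import Data.Bool.Properties as Bool
  open import Data.Empty using (⊥)
  open import Data.Integer as ℤ using (ℤ; +_; -[1+_]; 0ℤ; 1ℤ; -1ℤ; -_; _+_; _-_; _*_; _^_)
  import Data.Integer.Properties as ℤ
  open import Data.Integer.Solver using () renaming (module +-*-Solver to ℤ-Solver)
  open import Data.List using (length; reverse)
  import Data.List.Properties as List
  open import Data.Nat as ℕ using (ℕ; zero; suc; _∸_; z≤n; s≤s; _≤_; _<_)
  import Data.Nat.Properties as ℕ
  open import Data.Nat.Coprimality using (Coprime; coprime-divisor)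
  open import Data.Nat.Divisibility
  open import Data.Nat.Induction using (<-rec)
  open import Data.Nat.Primality using (Prime; prime⇒irreducible; prime⇒nonZero; prime⇒nonTrivial; euclidsLemma; prime[2])
  open import Data.Product using (_×_; _,_; proj₁; proj₂; Σ; ∃)
  open import Data.Sum using (_⊎_; inj₁; inj₂)
  open import Function using (case_of_; _∘_)
  open import Level using (0ℓ)
  open import Relation.Binary.Definitions using (tri<; tri≈; tri>)
  open import Relation.Binary.PropositionalEquality
  import Relation.Binary.Reasoning.Setoid
  open import Relation.Nullary using (¬_; Dec; yes; no; does)
  open import Relation.Nullary.Decidable using (dec-true)
  open import Relation.Nullary.Negation using (contradiction)

  Index : ℕ → Set
  Index i = 1 ≤ i × i ≤ t

  p-prime : ∀ {i} → Index i → Prime (p i)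
  p-prime (1≤i , i≤t) = proj₁ (p-prime-odd _ 1≤i i≤t)

  p-odd : ∀ {i} → Index i → 2 ∤ p i
  p-odd (1≤i , i≤t) = proj₂ (p-prime-odd _ 1≤i i≤t)

  3≤p : ∀ {i} → Index i → 3 ≤ p i
  3≤p {i} i∈ with p i | ℕ.nonTrivial⇒n>1 (p i) {{prime⇒nonTrivial (p-prime i∈)}} | p-odd i∈
  ... | suc zero | s≤s () | _
  ... | suc (suc zero) | _ | 2∤2 = contradiction ∣-refl 2∤2
  ... | suc (suc (suc _)) | _ | _ = s≤s (s≤s (s≤s z≤n))

  p-injective : ∀ {i j} → Index i → Index j → p i ≡ p j → i ≡ j
  p-injective {i} {j} (1≤i , i≤t) (1≤j , j≤t) pi≡pj with ℕ.<-cmp i j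
  ... | tri≈ _ i≡j _ = i≡j
  ... | tri< i<j _ _ = contradiction pi≡pj (ℕ.<⇒≢ (p-increasing i j 1≤i i<j j≤t))
  ... | tri> _ _ j<i = contradiction (sym pi≡pj) (ℕ.<⇒≢ (p-increasing j i 1≤j j<i i≤t))

  p∣p⇒≡ : ∀ {i j} → Index i → Index j → p i ∣ p j → i ≡ j
  p∣p⇒≡ i∈ j∈ pi∣pj with prime⇒irreducible (p-prime j∈) pi∣pj
  ... | inj₁ pi≡1 = contradiction pi≡1 (ℕ.>⇒≢ (ℕ.nonTrivial⇒n>1 _ {{prime⇒nonTrivial (p-prime i∈)}}))
  ... | inj₂ pi≡pj = p-injective i∈ j∈ pi≡pj

  p∣p*⇒≡⊎∣ : ∀ {i j} d → Index i → Index j → p j ∣ p i ℕ.* d → j ≡ i ⊎ p j ∣ d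
  p∣p*⇒≡⊎∣ {i} d i∈ j∈ pj∣pi*d with euclidsLemma (p i) d (p-prime j∈) pj∣pi*d
  ... | inj₁ pj∣pi = inj₁ (p∣p⇒≡ j∈ i∈ pj∣pi)
  ... | inj₂ pj∣d = inj₂ pj∣d

  2∣p*⇒2∣ : ∀ {i} d → Index i → 2 ∣ p i ℕ.* d → 2 ∣ d
  2∣p*⇒2∣ {i} d i∈ 2∣pi*d with euclidsLemma (p i) d prime[2] 2∣pi*d
  ... | inj₁ 2∣pi = contradiction 2∣pi (p-odd i∈)
  ... | inj₂ 2∣d = 2∣d

  p∤1 : ∀ {j} → Index j → p j ∤ 1
  p∤1 j∈ pj∣1 = contradiction (∣⇒≤ pj∣1) (ℕ.<⇒≱ (ℕ.≤-trans (s≤s (s≤s z≤n)) (3≤p j∈)))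

  p∤2 : ∀ {j} → Index j → p j ∤ 2
  p∤2 j∈ pj∣2 = contradiction (∣⇒≤ pj∣2) (ℕ.<⇒≱ (3≤p j∈))

  p≤p : ∀ {i j} → 1 ≤ i → i ≤ j → j ≤ t → p i ≤ p j
  p≤p {i} 1≤i i≤j j≤t with ℕ.m≤n⇒m<n∨m≡n i≤j
  ... | inj₁ i<j = ℕ.<⇒≤ (p-increasing _ _ 1≤i i<j j≤t)
  ... | inj₂ refl = ℕ.≤-refl

  N : ℕ
  N = 2 ℕ.* prodRange p t

  1≤N : 1 ≤ N
  1≤N = ℕ.*-mono-≤ {1} {2} (s≤s z≤n) (positive t ℕ.≤-refl)
    where
    positive : ∀ u → u ≤ t → 1 ≤ prodRange p u
    positive zero _ = ℕ.≤-refl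
    positive (suc u) 1+u≤t = ℕ.*-mono-≤ (positive u (ℕ.≤-trans (ℕ.n≤1+n u) 1+u≤t)) (ℕ.≤-trans (s≤s z≤n) (3≤p (s≤s z≤n , 1+u≤t)))

  p∣prodRange : ∀ {i} u → 1 ≤ i → i ≤ u → p i ∣ prodRange p u
  p∣prodRange {suc _} zero _ ()
  p∣prodRange (suc u) 1≤i i≤1+u with ℕ.m≤n⇒m<n∨m≡n i≤1+u
  ... | inj₁ (s≤s i≤u) = ∣m⇒∣m*n (p (suc u)) (p∣prodRange u 1≤i i≤u)
  ... | inj₂ refl = n∣m*n (prodRange p u)

  p∣N : ∀ {i} → Index i → p i ∣ N
  p∣N (1≤i , i≤t) = ∣n⇒∣m*n 2 (p∣prodRange t 1≤i i≤t)

  prime-∣-prodRange : ∀ {q} u → Prime q → q ∣ prodRange p u → ∃ λ j → (1 ≤ j × j ≤ u) × q ∣ p j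
  prime-∣-prodRange zero q-prime q∣1 = contradiction (∣1⇒≡1 q∣1) (ℕ.nonTrivial⇒≢1 {{prime⇒nonTrivial q-prime}})
  prime-∣-prodRange (suc u) q-prime q∣prod with euclidsLemma (prodRange p u) (p (suc u)) q-prime q∣prod
  ... | inj₂ q∣p = suc u , (s≤s z≤n , ℕ.≤-refl) , q∣p
  ... | inj₁ q∣prod′ with prime-∣-prodRange u q-prime q∣prod′
  ...   | j , (1≤j , j≤u) , q∣pj = j , (1≤j , ℕ.m≤n⇒m≤1+n j≤u) , q∣pj

  2*prodRange-suc : ∀ u → 2 ℕ.* prodRange p (suc u) ≡ p (suc u) ℕ.* (2 ℕ.* prodRange p u)
  2*prodRange-suc u = trans (sym (ℕ.*-assoc 2 (prodRange p u) (p (suc u)))) (ℕ.*-comm _ (p (suc u)))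

  p²∤2*prodRange : ∀ {i} u → u ≤ t → 1 ≤ i → i ≤ u → p i ℕ.* p i ∤ 2 ℕ.* prodRange p u
  p²∤2*prodRange {suc _} zero _ _ ()
  p²∤2*prodRange {i} (suc u) 1+u≤t 1≤i i≤1+u p²∣ with ℕ.m≤n⇒m<n∨m≡n i≤1+u
  ... | inj₂ refl = impossible (euclidsLemma 2 (prodRange p u) (p-prime i∈) pi∣2*prod)
    where
    i∈ : Index i
    i∈ = 1≤i , 1+u≤t
    pi∣2*prod : p i ∣ 2 ℕ.* prodRange p u
    pi∣2*prod = *-cancelˡ-∣ (p i) {{prime⇒nonZero (p-prime i∈)}} (subst (p i ℕ.* p i ∣_) (2*prodRange-suc u) p²∣)
    impossible : p i ∣ 2 ⊎ p i ∣ prodRange p u → ⊥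
    impossible (inj₁ pi∣2) = p∤2 i∈ pi∣2
    impossible (inj₂ pi∣prod) with prime-∣-prodRange u (p-prime i∈) pi∣prod
    ... | j , (1≤j , j≤u) , pi∣pj = ℕ.<⇒≢ (s≤s j≤u) (sym (p∣p⇒≡ i∈ (1≤j , ℕ.≤-trans (ℕ.m≤n⇒m≤1+n j≤u) 1+u≤t) pi∣pj))
  ... | inj₁ (s≤s i≤u) = p²∤2*prodRange u (ℕ.≤-trans (ℕ.n≤1+n u) 1+u≤t) 1≤i i≤u
    (coprime-divisor coprime (subst (p i ℕ.* p i ∣_) (2*prodRange-suc u) p²∣))
    where
    i∈ : Index i
    i∈ = 1≤i , ℕ.≤-trans (ℕ.m≤n⇒m≤1+n i≤u) 1+u≤t
    1+u∈ : Index (suc u)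
    1+u∈ = s≤s z≤n , 1+u≤t
    coprime : Coprime (p i ℕ.* p i) (p (suc u))
    coprime (d∣p² , d∣p) with prime⇒irreducible (p-prime 1+u∈) d∣p
    ... | inj₁ d≡1 = d≡1
    ... | inj₂ refl with euclidsLemma (p i) (p i) (p-prime 1+u∈) d∣p²
    ...   | inj₁ p∣pi = contradiction (p∣p⇒≡ 1+u∈ i∈ p∣pi) (ℕ.>⇒≢ (s≤s i≤u))
    ...   | inj₂ p∣pi = contradiction (p∣p⇒≡ 1+u∈ i∈ p∣pi) (ℕ.>⇒≢ (s≤s i≤u))

  ∣2*prodRange⇒∣2 : ∀ {m} u → u ≤ t → m ∣ 2 ℕ.* prodRange p u → (∀ i → 1 ≤ i → i ≤ u → p i ∤ m) → m ∣ 2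
  ∣2*prodRange⇒∣2 zero _ m∣2 _ = m∣2
  ∣2*prodRange⇒∣2 {m} (suc u) 1+u≤t m∣ p∤m = ∣2*prodRange⇒∣2 u (ℕ.≤-trans (ℕ.n≤1+n u) 1+u≤t)
    (coprime-divisor (prime-∤⇒coprime (p-prime (s≤s z≤n , 1+u≤t)) (p∤m (suc u) (s≤s z≤n) ℕ.≤-refl))
      (subst (m ∣_) (2*prodRange-suc u) m∣))
    (λ i 1≤i i≤u → p∤m i 1≤i (ℕ.m≤n⇒m≤1+n i≤u))

  ∣2⇒≡1⊎≡2 : ∀ {m} → m ∣ 2 → m ≡ 1 ⊎ m ≡ 2
  ∣2⇒≡1⊎≡2 {zero} 0∣2 = contradiction (0∣⇒≡0 0∣2) (λ ())
  ∣2⇒≡1⊎≡2 {suc zero} _ = inj₁ refl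
  ∣2⇒≡1⊎≡2 {suc (suc zero)} _ = inj₂ refl
  ∣2⇒≡1⊎≡2 {suc (suc (suc m))} m∣2 = contradiction (∣⇒≤ m∣2) (λ { (s≤s (s≤s ())) })

  p∣?_ : ∀ m → (∃ λ i → Index i × p i ∣ m) ⊎ (∀ i → 1 ≤ i → i ≤ t → p i ∤ m)
  p∣? m = search t ℕ.≤-refl
    where
    search : ∀ u → u ≤ t → (∃ λ i → Index i × p i ∣ m) ⊎ (∀ i → 1 ≤ i → i ≤ u → p i ∤ m)
    search zero _ = inj₂ (λ { (suc i) _ () })
    search (suc u) 1+u≤t with p (suc u) ∣? m
    ... | yes pu∣m = inj₁ (suc u , (s≤s z≤n , 1+u≤t) , pu∣m)
    ... | no pu∤m with search u (ℕ.≤-trans (ℕ.n≤1+n u) 1+u≤t)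
    ...   | inj₁ found = inj₁ found
    ...   | inj₂ none = inj₂ λ i 1≤i i≤1+u → case ℕ.m≤n⇒m<n∨m≡n i≤1+u of λ where
                          (inj₁ (s≤s i≤u)) → none i 1≤i i≤u
                          (inj₂ refl) → pu∤m

  NoOddPrime : ℕ → Set
  NoOddPrime m = ∀ {j} → Index j → p j ∤ m

  data DivisorView (m : ℕ) : Set where
    one : m ≡ 1 → DivisorView m
    two : m ≡ 2 → DivisorView m
    prime* : ∀ i m′ → Index i → m ≡ p i ℕ.* m′ → p i ∤ m′ → 1 ≤ m′ → m′ ∣ N → m′ < m → DivisorView m

  divisorView : ∀ m → m ∣ N → 1 ≤ m → DivisorView m
  divisorView m m∣N 1≤m with p∣? m
  ... | inj₂ none with ∣2⇒≡1⊎≡2 (∣2*prodRange⇒∣2 t ℕ.≤-refl m∣N none)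
  ...   | inj₁ m≡1 = one m≡1
  ...   | inj₂ m≡2 = two m≡2
  divisorView m m∣N 1≤m | inj₁ (i , i∈ , pi∣m) =
    prime* i m′ i∈ m≡pi*m′ pi∤m′ 1≤m′ (∣-trans (quotient-∣ pi∣m) m∣N) (quotient-< pi∣m)
    where
    instance
      _ = prime⇒nonTrivial (p-prime i∈)
      _ = ℕ.>-nonZero 1≤m
    m′ = quotient pi∣m
    m≡pi*m′ : m ≡ p i ℕ.* m′
    m≡pi*m′ = m∣n⇒n≡m*quotient pi∣m
    pi∤m′ : p i ∤ m′
    pi∤m′ pi∣m′ = p²∤2*prodRange t ℕ.≤-refl (proj₁ i∈) (proj₂ i∈)
      (∣-trans (subst (p i ℕ.* p i ∣_) (sym m≡pi*m′) (*-monoʳ-∣ (p i) pi∣m′)) m∣N)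
    1≤m′ : 1 ≤ m′
    1≤m′ = ℕ.n≢0⇒n>0 λ m′≡0 → ℕ.>⇒≢ 1≤m (trans m≡pi*m′ (trans (cong (p i ℕ.*_) m′≡0) (ℕ.*-zeroʳ (p i))))

  module PrimeProduct {c ℓ} (M : CommutativeMonoid c ℓ) where

    open CommutativeMonoid M using (_≈_; _∙_; ε; identityʳ) renaming (Carrier to A; refl to ≈-refl; sym to ≈-sym)
    open BigOperatorProperties M

    infix 25 Π[p∣_]_

    Π[p∣_]_ : ℕ → (ℕ → A) → A
    Π[p∣ d ] h = Π[≤ t ] (λ j → when (p j ∣? d) (h j))

    Π[p∣]-p* : ∀ {i} d h → Index i → p i ∤ d → Π[p∣ p i ℕ.* d ] h ≈ h i ∙ Π[p∣ d ] h
    Π[p∣]-p* {i} d h i∈@(1≤i , i≤t) pi∤d = Π-update t i (h i) 1≤i i≤t others self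
      where
      others : ∀ j → 1 ≤ j → j ≤ t → j ≢ i → when (p j ∣? p i ℕ.* d) (h j) ≈ when (p j ∣? d) (h j)
      others j 1≤j j≤t j≢i with p j ∣? p i ℕ.* d | p j ∣? d
      ... | yes _ | yes _ = ≈-refl
      ... | no _ | no _ = ≈-refl
      ... | yes pj∣pi*d | no pj∤d = case p∣p*⇒≡⊎∣ d i∈ (1≤j , j≤t) pj∣pi*d of λ where
        (inj₁ j≡i) → contradiction j≡i j≢i
        (inj₂ pj∣d) → contradiction pj∣d pj∤d
      ... | no pj∤pi*d | yes pj∣d = contradiction (∣n⇒∣m*n (p i) pj∣d) pj∤pi*d
      self : when (p i ∣? p i ℕ.* d) (h i) ≈ h i ∙ when (p i ∣? d) (h i)
      self with p i ∣? p i ℕ.* d | p i ∣? d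
      ... | _ | yes pi∣d = contradiction pi∣d pi∤d
      ... | yes _ | no _ = ≈-sym (identityʳ _)
      ... | no pi∤pi*d | no _ = contradiction (m∣m*n d) pi∤pi*d

    Π[p∣]-none : ∀ d h → (∀ {j} → Index j → p j ∤ d) → Π[p∣ d ] h ≈ ε
    Π[p∣]-none d h p∤d = Π-identity t λ j 1≤j j≤t → nothing j (1≤j , j≤t)
      where
      nothing : ∀ j → Index j → when (p j ∣? d) (h j) ≈ ε
      nothing j j∈ with p j ∣? d
      ... | yes pj∣d = contradiction pj∣d (p∤d j∈)
      ... | no _ = ≈-refl

    Π[p∣N] : ∀ h → Π[p∣ N ] h ≈ Π[≤ t ] h
    Π[p∣N] h = Π-cong t λ j 1≤j j≤t → everything j (1≤j , j≤t)
      where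
      everything : ∀ j → Index j → when (p j ∣? N) (h j) ≈ h j
      everything j j∈ with p j ∣? N
      ... | yes _ = ≈-refl
      ... | no pj∤N = contradiction (p∣N j∈) pj∤N

  xor-commutativeMonoid : CommutativeMonoid 0ℓ 0ℓ
  xor-commutativeMonoid = CommutativeRing.+-commutativeMonoid Bool.xor-∧-commutativeRing

  module ΠX = PrimeProduct xor-commutativeMonoid

  module Πℕ = PrimeProduct ℕ.*-1-commutativeMonoid

  -- Whether an odd number of the p_j divide d (the prime 2 is not counted).
  ωOdd : ℕ → Bool
  ωOdd d = ΠX.Π[p∣ d ] (λ _ → true)

  isEven : ℕ → Bool
  isEven d = does (2 ∣? d)

  -- On the divisors of N this is Euler's totient.
  φ : ℕ → ℕ
  φ d = Πℕ.Π[p∣ d ] (λ j → p j ∸ 1)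

  ωOdd-p* : ∀ {i} d → Index i → p i ∤ d → ωOdd (p i ℕ.* d) ≡ not (ωOdd d)
  ωOdd-p* d i∈ pi∤d = trans (ΠX.Π[p∣]-p* d (λ _ → true) i∈ pi∤d) (Bool.true-xor _)

  isEven-p* : ∀ {i} d → Index i → isEven (p i ℕ.* d) ≡ isEven d
  isEven-p* {i} d i∈ = does-⇔ (2 ∣? p i ℕ.* d) (2 ∣? d) (2∣p*⇒2∣ d i∈) (∣n⇒∣m*n (p i))
    where
    does-⇔ : ∀ {P Q : Set} (P? : Dec P) (Q? : Dec Q) → (P → Q) → (Q → P) → does P? ≡ does Q?
    does-⇔ (yes _) (yes _) _ _ = refl
    does-⇔ (no _) (no _) _ _ = refl
    does-⇔ (yes P) (no ¬Q) P→Q _ = contradiction (P→Q P) ¬Q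
    does-⇔ (no ¬P) (yes Q) _ Q→P = contradiction (Q→P Q) ¬P

  φ-p* : ∀ {i} d → Index i → p i ∤ d → φ (p i ℕ.* d) ≡ (p i ∸ 1) ℕ.* φ d
  φ-p* d i∈ pi∤d = Πℕ.Π[p∣]-p* d (λ j → p j ∸ 1) i∈ pi∤d

  ωOdd-noOddPrime : ∀ {m} → NoOddPrime m → ωOdd m ≡ false
  ωOdd-noOddPrime {m} none = ΠX.Π[p∣]-none m (λ _ → true) none

  φ-noOddPrime : ∀ {m} → NoOddPrime m → φ m ≡ 1
  φ-noOddPrime {m} none = Πℕ.Π[p∣]-none m (λ j → p j ∸ 1) none

  φ-positive : ∀ d → 1 ≤ φ d
  φ-positive d = bound t ℕ.≤-refl
    where
    open BigOperator ℕ._*_ 1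
    bound : ∀ n → n ≤ t → 1 ≤ Π[≤ n ] (λ j → when (p j ∣? d) (p j ∸ 1))
    bound zero _ = ℕ.≤-refl
    bound (suc n) 1+n≤t = ℕ.*-mono-≤ (bound n (ℕ.≤-trans (ℕ.n≤1+n n) 1+n≤t)) (factor (p (suc n) ∣? d))
      where
      factor : ∀ {P : Set} (P? : Dec P) → 1 ≤ when P? (p (suc n) ∸ 1)
      factor (yes _) = ℕ.∸-monoˡ-≤ 1 (ℕ.≤-trans (s≤s (s≤s z≤n)) (3≤p (s≤s z≤n , 1+n≤t)))
      factor (no _) = ℕ.≤-refl

  module Σℕ = BigOperatorProperties ℕ.+-0-commutativeMonoid
    renaming (Π[≤_]_ to Σ[≤_]_; Π[∣_]_ to Σ[∣_]_; Π[∣_]′_ to Σ[∣_]′_)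

  open Σℕ using (Σ[≤_]_; Σ[∣_]_; Σ[∣_]′_)

  Σ[∣]-* : ∀ m c f → Σ[∣ m ] (λ d → c ℕ.* f d) ≡ c ℕ.* Σ[∣ m ] f
  Σ[∣]-* m c f = go m
    where
    go : ∀ n → Σ[≤ n ] Σℕ.divisorsOf m (λ d → c ℕ.* f d) ≡ c ℕ.* Σ[≤ n ] Σℕ.divisorsOf m f
    go zero = sym (ℕ.*-zeroʳ c)
    go (suc n) = trans (cong₂ ℕ._+_ (go n) (factor (suc n ∣? m))) (sym (ℕ.*-distribˡ-+ c _ _))
      where
      factor : ∀ {P : Set} (P? : Dec P) → Σℕ.when P? (c ℕ.* f (suc n)) ≡ c ℕ.* Σℕ.when P? (f (suc n))
      factor (yes _) = refl
      factor (no _) = sym (ℕ.*-zeroʳ c)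

  Σ[∣]-φ : ∀ {m} → m ∣ N → 1 ≤ m → Σ[∣ m ] φ ≡ m
  Σ[∣]-φ {m} = <-rec (λ m → m ∣ N → 1 ≤ m → Σ[∣ m ] φ ≡ m) step m
    where
    step : ∀ m → (∀ {m′} → m′ < m → m′ ∣ N → 1 ≤ m′ → Σ[∣ m′ ] φ ≡ m′) → m ∣ N → 1 ≤ m → Σ[∣ m ] φ ≡ m
    step m IH m∣N 1≤m with divisorView m m∣N 1≤m
    ... | one refl = trans (Σℕ.Π[∣1] φ) (φ-noOddPrime p∤1)
    ... | two refl = trans (Σℕ.Π[∣2] φ) (cong₂ ℕ._+_ (φ-noOddPrime p∤1) (φ-noOddPrime p∤2))
    ... | prime* i m′ i∈ refl pi∤m′ 1≤m′ m′∣N m′<m = begin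
      Σ[∣ p i ℕ.* m′ ] φ
        ≡⟨ Σℕ.Π[∣]-prime-* φ (p-prime i∈) pi∤m′ 1≤m′ ⟩
      Σ[∣ m′ ] (λ d → φ d ℕ.+ φ (p i ℕ.* d))
        ≡⟨ Σℕ.Π[∣]-cong m′ (λ d d∣m′ → φ+φ-p* d (λ pi∣d → pi∤m′ (∣-trans pi∣d d∣m′))) ⟩
      Σ[∣ m′ ] (λ d → p i ℕ.* φ d)
        ≡⟨ Σ[∣]-* m′ (p i) φ ⟩
      p i ℕ.* Σ[∣ m′ ] φ
        ≡⟨ cong (p i ℕ.*_) (IH m′<m m′∣N 1≤m′) ⟩
      p i ℕ.* m′
        ∎
      where
      open ≡-Reasoning
      φ+φ-p* : ∀ d → p i ∤ d → φ d ℕ.+ φ (p i ℕ.* d) ≡ p i ℕ.* φ d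
      φ+φ-p* d pi∤d = begin
        φ d ℕ.+ φ (p i ℕ.* d)             ≡⟨ cong (φ d ℕ.+_) (φ-p* d i∈ pi∤d) ⟩
        φ d ℕ.+ (p i ∸ 1) ℕ.* φ d         ≡⟨⟩
        suc (p i ∸ 1) ℕ.* φ d             ≡⟨ cong (ℕ._* φ d) (ℕ.m+[n∸m]≡n (ℕ.≤-trans (s≤s z≤n) (3≤p i∈))) ⟩
        p i ℕ.* φ d                       ∎

  -- The reciprocals Φʳ d modulo y^K

  K : ℕ
  K = p 1 ℕ.+ p 2

  K≤p+p-< : ∀ {i j} → Index i → Index j → i < j → K ≤ p i ℕ.+ p j
  K≤p+p-< (1≤i , i≤t) (_ , j≤t) i<j = ℕ.+-mono-≤ (p≤p (s≤s z≤n) 1≤i i≤t) (p≤p (s≤s z≤n) (ℕ.≤-trans (s≤s 1≤i) i<j) j≤t)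

  K≤p+p : ∀ {i j} → Index i → Index j → i ≢ j → K ≤ p i ℕ.+ p j
  K≤p+p {i} {j} i∈ j∈ i≢j with ℕ.<-cmp i j
  ... | tri< i<j _ _ = K≤p+p-< i∈ j∈ i<j
  ... | tri≈ _ i≡j _ = contradiction i≡j i≢j
  ... | tri> _ _ j<i = subst (K ≤_) (ℕ.+-comm (p j) (p i)) (K≤p+p-< j∈ i∈ j<i)

  K≤1+[p∸1]*[p∸1] : ∀ {i j} → Index i → Index j → i ≢ j → K ≤ suc ((p i ∸ 1) ℕ.* (p j ∸ 1))
  K≤1+[p∸1]*[p∸1] {i} {j} i∈ j∈ i≢j =
    ℕ.≤-trans (K≤p+p i∈ j∈ i≢j) (odd-primes (3≤p i∈) (3≤p j∈) (i≢j ∘ p-injective i∈ j∈))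
    where
    odd-primes : ∀ {m n} → 3 ≤ m → 3 ≤ n → m ≢ n → m ℕ.+ n ≤ suc ((m ∸ 1) ℕ.* (n ∸ 1))
    odd-primes {m} {n} 3≤m 3≤n m≢n with ℕ.m≤n⇒m<n∨m≡n 3≤n | ℕ.m≤n⇒m<n∨m≡n 3≤m
    ... | inj₁ 4≤n | _ = m+n≤1+[m∸1]*[n∸1] 3≤m 4≤n
    ... | inj₂ refl | inj₁ 4≤m =
      subst₂ _≤_ (ℕ.+-comm n m) (cong suc (ℕ.*-comm (n ∸ 1) (m ∸ 1))) (m+n≤1+[m∸1]*[n∸1] 3≤n 4≤m)
    ... | inj₂ refl | inj₂ refl = contradiction refl m≢n

  𝕊 : CommutativeMonoid 0ℓ 0ℓ
  𝕊 = truncated-*ₛ-commutativeMonoid K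

  module S = BigOperatorProperties 𝕊

  module ΠS = PrimeProduct 𝕊

  open CommutativeMonoid 𝕊 using () renaming
    (refl to ≈-refl; sym to ≈-sym; trans to ≈-trans; ∙-cong to *ₛ-congₖ; ∙-congˡ to *ₛ-congˡₖ; ∙-congʳ to *ₛ-congʳₖ;
     identityˡ to *ₛ-identityˡₖ; identityʳ to *ₛ-identityʳₖ; comm to *ₛ-commₖ)

  module ≈ₖ-Reasoning = Relation.Binary.Reasoning.Setoid (CommutativeMonoid.setoid 𝕊)

  open import Algebra.Solver.CommutativeMonoid 𝕊 using (_⊜_; _⊕_; id) renaming (solve to solve-*ₛ)

  oddFactors : Bool → ℕ → Series
  oddFactors e d = ΠS.Π[p∣ d ] (λ j → 1∓y^ e (p j))

  -- With e = [2 ∣ d], the product of the 1 ∓ y^{p_j} over the odd primes of d stands over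
  -- 1 ∓ y or under it according to the parity of the number of those primes.
  num den : ℕ → Series
  num d = if ωOdd d then oddFactors (isEven d) d else 1∓y^ (isEven d) 1
  den d = if ωOdd d then 1∓y^ (isEven d) 1 else oddFactors (isEven d) d

  -- Passing from d to p_i d contributes gain i d to the numerators if ωOdd d is false,
  -- and to the denominators if it is true.
  gain ifOdd-gain ifEven-gain : ℕ → ℕ → Series
  gain i d = 1∓y^ (isEven d) (p i)
  ifOdd-gain i d = if ωOdd d then gain i d else 1ₛ
  ifEven-gain i d = if ωOdd d then 1ₛ else gain i d

  oddFactors-p* : ∀ {i} e d → Index i → p i ∤ d → oddFactors e (p i ℕ.* d) ≈[ K ] 1∓y^ e (p i) *ₛ oddFactors e d
  oddFactors-p* e d i∈ pi∤d = ΠS.Π[p∣]-p* d (λ j → 1∓y^ e (p j)) i∈ pi∤d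

  fraction-swap : ∀ s (L A A′ c : Series) → A′ ≈[ K ] c *ₛ A →
    (if s then A else L) *ₛ (if not s then A′ else L) *ₛ (if s then c else 1ₛ)
      ≈[ K ] (if s then L else A) *ₛ (if not s then L else A′) *ₛ (if s then 1ₛ else c)
  fraction-swap false L A A′ c A′≈cA = begin
    L *ₛ A′ *ₛ 1ₛ         ≈⟨ *ₛ-congʳₖ (*ₛ-congˡₖ A′≈cA) ⟩
    L *ₛ (c *ₛ A) *ₛ 1ₛ   ≈⟨ solve-*ₛ 3 (λ l a c → (l ⊕ (c ⊕ a)) ⊕ id ⊜ (a ⊕ l) ⊕ c) ≈-refl L A c ⟩
    A *ₛ L *ₛ c           ∎
    where open ≈ₖ-Reasoning
  fraction-swap true L A A′ c A′≈cA = begin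
    A *ₛ L *ₛ c           ≈⟨ solve-*ₛ 3 (λ l a c → (a ⊕ l) ⊕ c ⊜ (l ⊕ (c ⊕ a)) ⊕ id) ≈-refl L A c ⟩
    L *ₛ (c *ₛ A) *ₛ 1ₛ   ≈⟨ *ₛ-congʳₖ (*ₛ-congˡₖ A′≈cA) ⟨
    L *ₛ A′ *ₛ 1ₛ         ∎
    where open ≈ₖ-Reasoning

  num-den-p* : ∀ {i} d → Index i → p i ∤ d →
    num d *ₛ num (p i ℕ.* d) *ₛ ifOdd-gain i d ≈[ K ] den d *ₛ den (p i ℕ.* d) *ₛ ifEven-gain i d
  num-den-p* {i} d i∈ pi∤d
    rewrite isEven-p* d i∈ | ωOdd-p* d i∈ pi∤d
    = fraction-swap (ωOdd d) (1∓y^ (isEven d) 1) (oddFactors (isEven d) d) (oddFactors (isEven d) (p i ℕ.* d))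
        (gain i d) (oddFactors-p* (isEven d) d i∈ pi∤d)

  ifOdd-gain-p* : ∀ i {j} d → Index j → p j ∤ d → ifOdd-gain i d *ₛ ifOdd-gain i (p j ℕ.* d) ≈[ K ] gain i d
  ifOdd-gain-p* i d j∈ pj∤d rewrite isEven-p* d j∈ | ωOdd-p* d j∈ pj∤d with ωOdd d
  ... | false = *ₛ-identityˡₖ (gain i d)
  ... | true = *ₛ-identityʳₖ (gain i d)

  ifEven-gain-p* : ∀ i {j} d → Index j → p j ∤ d → ifEven-gain i d *ₛ ifEven-gain i (p j ℕ.* d) ≈[ K ] gain i d
  ifEven-gain-p* i d j∈ pj∤d rewrite isEven-p* d j∈ | ωOdd-p* d j∈ pj∤d with ωOdd d
  ... | false = *ₛ-identityʳₖ (gain i d)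
  ... | true = *ₛ-identityˡₖ (gain i d)

  oddFactors-noOddPrime : ∀ e {m} → NoOddPrime m → oddFactors e m ≈[ K ] 1ₛ
  oddFactors-noOddPrime e {m} none = ΠS.Π[p∣]-none m (λ j → 1∓y^ e (p j)) none

  num-noOddPrime : ∀ {m} → NoOddPrime m → num m ≡ 1∓y^ (isEven m) 1
  num-noOddPrime {m} none = cong (λ s → if s then oddFactors (isEven m) m else 1∓y^ (isEven m) 1) (ωOdd-noOddPrime none)

  den-noOddPrime : ∀ {m} → NoOddPrime m → den m ≈[ K ] 1ₛ
  den-noOddPrime {m} none rewrite ωOdd-noOddPrime none = oddFactors-noOddPrime (isEven m) none

  num-p*noOddPrime : ∀ {i m} → Index i → NoOddPrime m → num (p i ℕ.* m) ≈[ K ] 1∓y^ (isEven m) (p i)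
  num-p*noOddPrime {i} {m} i∈ none
    rewrite isEven-p* m i∈ | ωOdd-p* m i∈ (none i∈) | ωOdd-noOddPrime none = begin
    oddFactors (isEven m) (p i ℕ.* m)                 ≈⟨ oddFactors-p* (isEven m) m i∈ (none i∈) ⟩
    1∓y^ (isEven m) (p i) *ₛ oddFactors (isEven m) m  ≈⟨ *ₛ-congˡₖ (oddFactors-noOddPrime (isEven m) none) ⟩
    1∓y^ (isEven m) (p i) *ₛ 1ₛ                       ≈⟨ *ₛ-identityʳₖ _ ⟩
    1∓y^ (isEven m) (p i)                             ∎
    where open ≈ₖ-Reasoning

  den-p*noOddPrime : ∀ {i m} → Index i → NoOddPrime m → den (p i ℕ.* m) ≡ 1∓y^ (isEven m) 1
  den-p*noOddPrime {i} {m} i∈ none rewrite isEven-p* m i∈ | ωOdd-p* m i∈ (none i∈) | ωOdd-noOddPrime none = refl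

  ifEven-gain-noOddPrime : ∀ i {m} → NoOddPrime m → ifEven-gain i m ≡ gain i m
  ifEven-gain-noOddPrime i {m} none = cong (λ s → if s then 1ₛ else gain i m) (ωOdd-noOddPrime none)

  ifOdd-gain-noOddPrime : ∀ i {m} → NoOddPrime m → ifOdd-gain i m ≡ 1ₛ
  ifOdd-gain-noOddPrime i {m} none = cong (λ s → if s then gain i m else 1ₛ) (ωOdd-noOddPrime none)

  1∓y^p-constantOne : ∀ e {j} → Index j → ConstantOne (1∓y^ e (p j))
  1∓y^p-constantOne e j∈ = 1∓y^-constantOne e _ (ℕ.≤-trans (s≤s z≤n) (3≤p j∈))

  oddFactors-constantOne : ∀ e d → ConstantOne (oddFactors e d)
  oddFactors-constantOne e d = Π-constantOne t λ j 1≤j j≤t → when-constantOne (p j ∣? d) (1∓y^p-constantOne e (1≤j , j≤t))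

  num-constantOne : ∀ d → ConstantOne (num d)
  num-constantOne d = if-constantOne (ωOdd d) (oddFactors-constantOne (isEven d) d) (1∓y^-constantOne (isEven d) 1 ℕ.≤-refl)

  den-constantOne : ∀ d → ConstantOne (den d)
  den-constantOne d = if-constantOne (ωOdd d) (1∓y^-constantOne (isEven d) 1 ℕ.≤-refl) (oddFactors-constantOne (isEven d) d)

  ifOdd-gain-constantOne : ∀ {i} d → Index i → ConstantOne (ifOdd-gain i d)
  ifOdd-gain-constantOne d i∈ = if-constantOne (ωOdd d) (1∓y^p-constantOne (isEven d) i∈) refl

  Π[∣]-constantOne : ∀ m n f → (∀ d → ConstantOne (f d)) → ConstantOne (S.Π[≤ n ] S.divisorsOf m f)
  Π[∣]-constantOne m n f f₀≡1 = Π-constantOne n λ d _ _ → when-constantOne (d ∣? m) (f₀≡1 d)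

  -- Beyond m ∈ {1, 2} the gains pair off along any odd prime of m, and 1 - yᵐ ≡ 1 mod y^K.
  Π[∣]-gains : ∀ {i m} → Index i → p i ∤ m → 1 ≤ m → m ∣ N →
    S.Π[∣ m ] (ifEven-gain i) ≈[ K ] 1-y^ (p i ℕ.* m) *ₛ S.Π[∣ m ] (ifOdd-gain i)
  Π[∣]-gains {i} {m} i∈ pi∤m 1≤m m∣N with divisorView m m∣N 1≤m
  ... | one refl = begin
    S.Π[∣ 1 ] (ifEven-gain i)                        ≈⟨ S.Π[∣1] (ifEven-gain i) ⟩
    ifEven-gain i 1                                  ≡⟨ ifEven-gain-noOddPrime i p∤1 ⟩
    1-y^ (p i)                                       ≡⟨ cong 1-y^ (ℕ.*-identityʳ (p i)) ⟨
    1-y^ (p i ℕ.* 1)                                 ≈⟨ *ₛ-identityʳₖ _ ⟨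
    1-y^ (p i ℕ.* 1) *ₛ 1ₛ                           ≡⟨ cong (1-y^ (p i ℕ.* 1) *ₛ_) (ifOdd-gain-noOddPrime i p∤1) ⟨
    1-y^ (p i ℕ.* 1) *ₛ ifOdd-gain i 1               ≈⟨ *ₛ-congˡₖ (S.Π[∣1] (ifOdd-gain i)) ⟨
    1-y^ (p i ℕ.* 1) *ₛ S.Π[∣ 1 ] (ifOdd-gain i)     ∎
    where open ≈ₖ-Reasoning
  ... | two refl = begin
    S.Π[∣ 2 ] (ifEven-gain i)
      ≈⟨ S.Π[∣2] (ifEven-gain i) ⟩
    ifEven-gain i 1 *ₛ ifEven-gain i 2
      ≡⟨ cong₂ _*ₛ_ (ifEven-gain-noOddPrime i p∤1) (ifEven-gain-noOddPrime i p∤2) ⟩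
    1-y^ (p i) *ₛ 1+y^ (p i)
      ≈⟨ (λ k _ → 1-y^*1+y^ (p i) k) ⟩
    1-y^ (p i ℕ.+ p i)
      ≡⟨ cong 1-y^ (trans (cong (p i ℕ.+_) (sym (ℕ.+-identityʳ (p i)))) (ℕ.*-comm 2 (p i))) ⟩
    1-y^ (p i ℕ.* 2)
      ≈⟨ *ₛ-identityʳₖ _ ⟨
    1-y^ (p i ℕ.* 2) *ₛ 1ₛ
      ≈⟨ *ₛ-congˡₖ (*ₛ-identityˡₖ 1ₛ) ⟨
    1-y^ (p i ℕ.* 2) *ₛ (1ₛ *ₛ 1ₛ)
      ≡⟨ cong (λ X → 1-y^ (p i ℕ.* 2) *ₛ X)
           (cong₂ _*ₛ_ (ifOdd-gain-noOddPrime i p∤1) (ifOdd-gain-noOddPrime i p∤2)) ⟨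
    1-y^ (p i ℕ.* 2) *ₛ (ifOdd-gain i 1 *ₛ ifOdd-gain i 2)
      ≈⟨ *ₛ-congˡₖ (S.Π[∣2] (ifOdd-gain i)) ⟨
    1-y^ (p i ℕ.* 2) *ₛ S.Π[∣ 2 ] (ifOdd-gain i)
      ∎
    where open ≈ₖ-Reasoning
  ... | prime* j m′ j∈ refl pj∤m′ 1≤m′ _ _ = begin
    S.Π[∣ p j ℕ.* m′ ] (ifEven-gain i)
      ≈⟨ S.Π[∣]-prime-* (ifEven-gain i) (p-prime j∈) pj∤m′ 1≤m′ ⟩
    S.Π[∣ m′ ] (λ d → ifEven-gain i d *ₛ ifEven-gain i (p j ℕ.* d))
      ≈⟨ S.Π[∣]-cong m′ (λ d d∣m′ →
           ≈-trans (ifEven-gain-p* i d j∈ (pj∤ d∣m′)) (≈-sym (ifOdd-gain-p* i d j∈ (pj∤ d∣m′)))) ⟩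
    S.Π[∣ m′ ] (λ d → ifOdd-gain i d *ₛ ifOdd-gain i (p j ℕ.* d))
      ≈⟨ S.Π[∣]-prime-* (ifOdd-gain i) (p-prime j∈) pj∤m′ 1≤m′ ⟨
    S.Π[∣ p j ℕ.* m′ ] (ifOdd-gain i)
      ≈⟨ *ₛ-identityˡₖ _ ⟨
    1ₛ *ₛ S.Π[∣ p j ℕ.* m′ ] (ifOdd-gain i)
      ≈⟨ *ₛ-congʳₖ (1-y^≈1ₛ (p i ℕ.* (p j ℕ.* m′)) K≤pi*m) ⟨
    1-y^ (p i ℕ.* (p j ℕ.* m′)) *ₛ S.Π[∣ p j ℕ.* m′ ] (ifOdd-gain i)
      ∎
    where
    open ≈ₖ-Reasoning
    pj∤ : ∀ {d} → d ∣ m′ → p j ∤ d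
    pj∤ d∣m′ pj∣d = pj∤m′ (∣-trans pj∣d d∣m′)
    i≢j : i ≢ j
    i≢j refl = pi∤m (m∣m*n m′)
    K≤pi*m : K ≤ p i ℕ.* (p j ℕ.* m′)
    K≤pi*m = ℕ.≤-trans (K≤p+p i∈ j∈ i≢j)
      (ℕ.≤-trans (m+n≤m*n (ℕ.≤-trans (s≤s (s≤s z≤n)) (3≤p i∈)) (ℕ.≤-trans (s≤s (s≤s z≤n)) (3≤p j∈)))
        (ℕ.*-monoʳ-≤ (p i) (ℕ.m≤m*n (p j) m′ {{ℕ.>-nonZero 1≤m′}})))

  Π[∣]-num : ∀ {m} → m ∣ N → 1 ≤ m → S.Π[∣ m ] num ≈[ K ] 1-y^ m *ₛ S.Π[∣ m ] den
  Π[∣]-num {m} m∣N 1≤m with divisorView m m∣N 1≤m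
  ... | one refl = begin
    S.Π[∣ 1 ] num       ≈⟨ S.Π[∣1] num ⟩
    num 1               ≡⟨ num-noOddPrime p∤1 ⟩
    1-y^ 1              ≈⟨ *ₛ-identityʳₖ _ ⟨
    1-y^ 1 *ₛ 1ₛ        ≈⟨ *ₛ-congˡₖ (≈-trans (S.Π[∣1] den) (den-noOddPrime p∤1)) ⟨
    1-y^ 1 *ₛ S.Π[∣ 1 ] den ∎
    where open ≈ₖ-Reasoning
  ... | two refl = begin
    S.Π[∣ 2 ] num           ≈⟨ S.Π[∣2] num ⟩
    num 1 *ₛ num 2          ≡⟨ cong₂ _*ₛ_ (num-noOddPrime p∤1) (num-noOddPrime p∤2) ⟩
    1-y^ 1 *ₛ 1+y^ 1        ≈⟨ (λ k _ → 1-y^*1+y^ 1 k) ⟩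
    1-y^ 2                  ≈⟨ *ₛ-identityʳₖ _ ⟨
    1-y^ 2 *ₛ 1ₛ            ≈⟨ *ₛ-congˡₖ (*ₛ-identityˡₖ 1ₛ) ⟨
    1-y^ 2 *ₛ (1ₛ *ₛ 1ₛ)    ≈⟨ *ₛ-congˡₖ (*ₛ-congₖ (den-noOddPrime p∤1) (den-noOddPrime p∤2)) ⟨
    1-y^ 2 *ₛ (den 1 *ₛ den 2) ≈⟨ *ₛ-congˡₖ (S.Π[∣2] den) ⟨
    1-y^ 2 *ₛ S.Π[∣ 2 ] den ∎
    where open ≈ₖ-Reasoning
  ... | prime* i m′ i∈ refl pi∤m′ 1≤m′ m′∣N _ =
    *ₛ-cancelˡ {W} (Π[∣]-constantOne m′ m′ (ifOdd-gain i) (λ d → ifOdd-gain-constantOne d i∈)) (begin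
      W *ₛ S.Π[∣ m ] num
        ≈⟨ *ₛ-commₖ W _ ⟩
      S.Π[∣ m ] num *ₛ W
        ≈⟨ *ₛ-congʳₖ (S.Π[∣]-prime-* num (p-prime i∈) pi∤m′ 1≤m′) ⟩
      S.Π[∣ m′ ] (λ d → num d *ₛ num (p i ℕ.* d)) *ₛ W
        ≈⟨ S.Π[∣]-∙ m′ _ (ifOdd-gain i) ⟨
      S.Π[∣ m′ ] (λ d → num d *ₛ num (p i ℕ.* d) *ₛ ifOdd-gain i d)
        ≈⟨ S.Π[∣]-cong m′ (λ d d∣m′ → num-den-p* d i∈ (λ pi∣d → pi∤m′ (∣-trans pi∣d d∣m′))) ⟩
      S.Π[∣ m′ ] (λ d → den d *ₛ den (p i ℕ.* d) *ₛ ifEven-gain i d)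
        ≈⟨ S.Π[∣]-∙ m′ _ (ifEven-gain i) ⟩
      S.Π[∣ m′ ] (λ d → den d *ₛ den (p i ℕ.* d)) *ₛ Z
        ≈⟨ *ₛ-congʳₖ (S.Π[∣]-prime-* den (p-prime i∈) pi∤m′ 1≤m′) ⟨
      S.Π[∣ m ] den *ₛ Z
        ≈⟨ *ₛ-congˡₖ (Π[∣]-gains i∈ pi∤m′ 1≤m′ m′∣N) ⟩
      S.Π[∣ m ] den *ₛ (1-y^ m *ₛ W)
        ≈⟨ solve-*ₛ 3 (λ a b c → a ⊕ (b ⊕ c) ⊜ c ⊕ (b ⊕ a)) ≈-refl (S.Π[∣ m ] den) (1-y^ m) W ⟩
      W *ₛ (1-y^ m *ₛ S.Π[∣ m ] den)
        ∎)
    where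
    open ≈ₖ-Reasoning
    W Z : Series
    W = S.Π[∣ m′ ] (ifOdd-gain i)
    Z = S.Π[∣ m′ ] (ifEven-gain i)

  den*linear≈num : ∀ {m} → NoOddPrime m → den m *ₛ coeff (linear (isEven m)) ≈[ K ] num m
  den*linear≈num {m} none = begin
    den m *ₛ coeff (linear (isEven m))   ≈⟨ *ₛ-congʳₖ (den-noOddPrime none) ⟩
    1ₛ *ₛ coeff (linear (isEven m))      ≈⟨ *ₛ-identityˡₖ _ ⟩
    coeff (linear (isEven m))            ≈⟨ (λ k _ → coeff-linear (isEven m) k) ⟩
    1∓y^ (isEven m) 1                    ≡⟨ num-noOddPrime none ⟨
    num m                                ∎
    where open ≈ₖ-Reasoning

  den*geometric≈num : ∀ {i m} → Index i → NoOddPrime m →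
    den (p i ℕ.* m) *ₛ coeff (geometric (signOf (isEven m)) (p i)) ≈[ K ] num (p i ℕ.* m)
  den*geometric≈num {i} {m} i∈ none = begin
    den (p i ℕ.* m) *ₛ coeff (geometric (signOf (isEven m)) (p i))
      ≡⟨ cong (_*ₛ coeff (geometric (signOf (isEven m)) (p i))) (den-p*noOddPrime i∈ none) ⟩
    1∓y^ (isEven m) 1 *ₛ coeff (geometric (signOf (isEven m)) (p i))
      ≈⟨ (λ k _ → 1∓y^*geometric (isEven m) (p i) (p-odd i∈) k) ⟩
    1∓y^ (isEven m) (p i)
      ≈⟨ num-p*noOddPrime i∈ none ⟨
    num (p i ℕ.* m)
      ∎
    where open ≈ₖ-Reasoning

  ExplicitΦʳ : ℕ → Set
  ExplicitΦʳ m = Σ Poly λ Q → length Q ≡ suc (φ m) × den m *ₛ coeff Q ≈[ K ] num m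

  explicit-noOddPrime : ∀ {m} → NoOddPrime m → ExplicitΦʳ m
  explicit-noOddPrime none = linear _ , cong suc (sym (φ-noOddPrime none)) , den*linear≈num none

  explicit-p*noOddPrime : ∀ {i m} → Index i → NoOddPrime m → ExplicitΦʳ (p i ℕ.* m)
  explicit-p*noOddPrime {i} {m} i∈ none = geometric _ (p i) , length≡ , den*geometric≈num i∈ none
    where
    length≡ : length (geometric (signOf (isEven m)) (p i)) ≡ suc (φ (p i ℕ.* m))
    length≡ = begin
      length (geometric (signOf (isEven m)) (p i))   ≡⟨ length-geometric _ (p i) ⟩
      p i                                            ≡⟨ ℕ.m+[n∸m]≡n (ℕ.≤-trans (s≤s z≤n) (3≤p i∈)) ⟨
      suc (p i ∸ 1)                                  ≡⟨ cong suc (ℕ.*-identityʳ (p i ∸ 1)) ⟨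
      suc ((p i ∸ 1) ℕ.* 1)                          ≡⟨ cong (λ n → suc ((p i ∸ 1) ℕ.* n)) (φ-noOddPrime none) ⟨
      suc ((p i ∸ 1) ℕ.* φ m)                        ≡⟨ cong suc (φ-p* m i∈ (none i∈)) ⟨
      suc (φ (p i ℕ.* m))                            ∎
      where open ≡-Reasoning

  -- Unless K ≤ 1 + φ m, m is one of 1, 2, p, 2p, whose Φ_m have explicit reciprocals.
  K≤1+φ⊎explicitΦʳ : ∀ {m} → m ∣ N → 1 ≤ m → K ≤ suc (φ m) ⊎ ExplicitΦʳ m
  K≤1+φ⊎explicitΦʳ {m} m∣N 1≤m with divisorView m m∣N 1≤m
  ... | one refl = inj₂ (explicit-noOddPrime p∤1)
  ... | two refl = inj₂ (explicit-noOddPrime p∤2)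
  ... | prime* i m′ i∈ refl pi∤m′ 1≤m′ m′∣N _ with divisorView m′ m′∣N 1≤m′
  ...   | one refl = inj₂ (explicit-p*noOddPrime i∈ p∤1)
  ...   | two refl = inj₂ (explicit-p*noOddPrime i∈ p∤2)
  ...   | prime* j m″ j∈ refl pj∤m″ 1≤m″ _ _ = inj₁ (ℕ.≤-trans (K≤1+[p∸1]*[p∸1] i∈ j∈ i≢j) (s≤s (begin
    (p i ∸ 1) ℕ.* (p j ∸ 1)
      ≤⟨ ℕ.*-monoʳ-≤ (p i ∸ 1) (ℕ.m≤m*n (p j ∸ 1) (φ m″) {{ℕ.>-nonZero (φ-positive m″)}}) ⟩
    (p i ∸ 1) ℕ.* ((p j ∸ 1) ℕ.* φ m″)
      ≡⟨ cong ((p i ∸ 1) ℕ.*_) (φ-p* m″ j∈ pj∤m″) ⟨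
    (p i ∸ 1) ℕ.* φ (p j ℕ.* m″)
      ≡⟨ φ-p* (p j ℕ.* m″) i∈ pi∤m′ ⟨
    φ (p i ℕ.* (p j ℕ.* m″))
      ∎)))
    where
    open ℕ.≤-Reasoning
    i≢j : i ≢ j
    i≢j refl = pi∤m′ (m∣m*n m″)

  record ΦShape (m : ℕ) : Set where
    field
      length-Φ≡ : length (Φ m) ≡ suc (φ m)
      den*Φʳ≈num : den m *ₛ Φʳ m ≈[ K ] num m

  module ΦShapeStep {k} (m∣N : suc k ∣ N) (IH : ∀ {d} → 1 ≤ d → d < suc k → d ∣ suc k → ΦShape d) where

    private
      m = suc k

    Σ[∣]′-degree≡φ : Σ[∣ m ]′ (degree ∘ Φ) ≡ Σ[∣ m ]′ φ
    Σ[∣]′-degree≡φ = Σℕ.Π[∣]′-cong m λ d 1≤d d<m d∣m →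
      cong (ℕ._∸ 1) (ΦShape.length-Φ≡ (IH 1≤d d<m d∣m))

    length-Φ≡1+φ : length (Φ m) ≡ suc (φ m)
    length-Φ≡1+φ = begin
      length (Φ m)                                 ≡⟨ length-Φ k ⟩
      suc (m ∸ Σ[∣ m ]′ (degree ∘ Φ))              ≡⟨ cong (λ s → suc (m ∸ s)) Σ[∣]′-degree≡φ ⟩
      suc (m ∸ Σ[∣ m ]′ φ)                      ≡⟨ cong (λ s → suc (s ∸ Σ[∣ m ]′ φ)) (Σ[∣]-φ m∣N (s≤s z≤n)) ⟨
      suc (Σ[∣ m ] φ ∸ Σ[∣ m ]′ φ)           ≡⟨ cong (λ s → suc (s ∸ Σ[∣ m ]′ φ)) (Σℕ.Π[∣]-last k φ) ⟩
      suc (Σ[∣ m ]′ φ ℕ.+ φ m ∸ Σ[∣ m ]′ φ)  ≡⟨ cong suc (ℕ.m+n∸m≡n (Σ[∣ m ]′ φ) (φ m)) ⟩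
      suc (φ m)                                    ∎
      where open ≡-Reasoning

    Π[∣]′-num : S.Π[∣ m ]′ num ≈[ K ] S.Π[∣ m ]′ den *ₛ S.Π[∣ m ]′ Φʳ
    Π[∣]′-num = ≈-trans (S.Π[∣]′-cong m λ d 1≤d d<m d∣m → ≈-sym (ΦShape.den*Φʳ≈num (IH 1≤d d<m d∣m)))
      (S.Π[∣]′-∙ m den Φʳ)

    -- Long division determines Φʳ m only below y^{φ m + 1}.
    den*Φʳ≈num-upTo : ∀ {M} → M ≤ K → M ≤ suc (φ m) → den m *ₛ Φʳ m ≈[ M ] num m
    den*Φʳ≈num-upTo {M} M≤K M≤1+φ = *ₛ-cancelˡ {S.Π[∣ m ]′ num} (Π[∣]-constantOne m k num num-constantOne) λ i i<M →
      trans (regroup i (ℕ.<-≤-trans i<M M≤K))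
        (trans (*ₛ-congˡ-≈[] (S.Π[∣ m ]′ den *ₛ den m) (Φʳ-*ₛ-properDivisors k) i
                  (subst (i <_) (sym length-Φ≡1+φ) (ℕ.<-≤-trans i<M M≤1+φ)))
          (unfold i (ℕ.<-≤-trans i<M M≤K)))
      where
      regroup : S.Π[∣ m ]′ num *ₛ (den m *ₛ Φʳ m) ≈[ K ] (S.Π[∣ m ]′ den *ₛ den m) *ₛ (Φʳ m *ₛ S.Π[∣ m ]′ Φʳ)
      regroup = ≈-trans (*ₛ-congʳₖ Π[∣]′-num)
        (solve-*ₛ 4 (λ a b c d → (a ⊕ b) ⊕ (c ⊕ d) ⊜ (a ⊕ c) ⊕ (d ⊕ b)) ≈-refl
          (S.Π[∣ m ]′ den) (S.Π[∣ m ]′ Φʳ) (den m) (Φʳ m))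
      unfold : (S.Π[∣ m ]′ den *ₛ den m) *ₛ 1-y^ m ≈[ K ] S.Π[∣ m ]′ num *ₛ num m
      unfold = begin
        (S.Π[∣ m ]′ den *ₛ den m) *ₛ 1-y^ m   ≈⟨ *ₛ-congʳₖ (S.Π[∣]-last k den) ⟨
        S.Π[∣ m ] den *ₛ 1-y^ m               ≈⟨ *ₛ-commₖ _ _ ⟩
        1-y^ m *ₛ S.Π[∣ m ] den               ≈⟨ Π[∣]-num m∣N (s≤s z≤n) ⟨
        S.Π[∣ m ] num                         ≈⟨ S.Π[∣]-last k num ⟩
        S.Π[∣ m ]′ num *ₛ num m               ∎
        where open ≈ₖ-Reasoning

    den*Φʳ≈num-explicit : suc (φ m) ≤ K → ExplicitΦʳ m → den m *ₛ Φʳ m ≈[ K ] num m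
    den*Φʳ≈num-explicit 1+φ≤K (Q , length-Q , den*Q≈num) i i<K =
      trans (*ₛ-cong (λ _ → refl) Φʳ≗Q i) (den*Q≈num i i<K)
      where
      Φʳ≈Q : Φʳ m ≈[ suc (φ m) ] coeff Q
      Φʳ≈Q = *ₛ-cancelˡ {den m} (den-constantOne m) λ j j<1+φ →
        trans (den*Φʳ≈num-upTo 1+φ≤K ℕ.≤-refl j j<1+φ) (sym (den*Q≈num j (ℕ.<-≤-trans j<1+φ 1+φ≤K)))
      Φʳ≗Q : Φʳ m ≗ coeff Q
      Φʳ≗Q = coeff-≈[length]⇒≗ {reverse (Φ m)} {Q} (trans (List.length-reverse (Φ m)) length-Φ≡1+φ) length-Q Φʳ≈Q

    den*Φʳ≈num : den m *ₛ Φʳ m ≈[ K ] num m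
    den*Φʳ≈num with K ℕ.≤? suc (φ m)
    ... | yes K≤1+φ = den*Φʳ≈num-upTo ℕ.≤-refl K≤1+φ
    ... | no K≰1+φ with K≤1+φ⊎explicitΦʳ m∣N (s≤s z≤n)
    ...   | inj₁ K≤1+φ = contradiction K≤1+φ K≰1+φ
    ...   | inj₂ explicit = den*Φʳ≈num-explicit (ℕ.<⇒≤ (ℕ.≰⇒> K≰1+φ)) explicit

    shape : ΦShape m
    shape = record { length-Φ≡ = length-Φ≡1+φ ; den*Φʳ≈num = den*Φʳ≈num }

  ΦShape-divisor : ∀ {m} → m ∣ N → 1 ≤ m → ΦShape m
  ΦShape-divisor {m} = <-rec (λ m → m ∣ N → 1 ≤ m → ΦShape m) step m
    where
    step : ∀ m → (∀ {m′} → m′ < m → m′ ∣ N → 1 ≤ m′ → ΦShape m′) → m ∣ N → 1 ≤ m → ΦShape m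
    step (suc k) IH m∣N _ = ΦShapeStep.shape m∣N λ 1≤d d<m d∣m → IH d<m (∣-trans d∣m m∣N) 1≤d

  -- The coefficients of Φ_N

  count : ℕ → ℕ → ℕ
  count u k = Σ[≤ u ] (λ j → Σℕ.when (p j ℕ.≟ k) 1)

  count-none : ∀ u k → (∀ j → 1 ≤ j → j ≤ u → p j ≢ k) → count u k ≡ 0
  count-none u k pj≢k = Σℕ.Π-identity u λ j 1≤j j≤u → absent j (pj≢k j 1≤j j≤u)
    where
    absent : ∀ j → p j ≢ k → Σℕ.when (p j ℕ.≟ k) 1 ≡ 0
    absent j pj≢k with p j ℕ.≟ k
    ... | yes pj≡k = contradiction pj≡k pj≢k
    ... | no _ = refl

  shiftBy-next-p : ∀ {u} (F : Series) → suc u ≤ t → (∀ k → k < K → F k ≡ 1ₛ k + + count u k) →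
    ∀ k → k < K → shiftBy (p (suc u)) F k ≡ + Σℕ.when (p (suc u) ℕ.≟ k) 1
  shiftBy-next-p {u} F 1+u≤t F≡ k k<K with p (suc u) ℕ.≟ k
  ... | yes refl = begin
    shiftBy q F q               ≡⟨ cong (shiftBy q F) (ℕ.+-identityʳ q) ⟨
    shiftBy q F (q ℕ.+ 0)       ≡⟨ shiftBy-+ˡ q F 0 ⟩
    F 0                         ≡⟨ F≡ 0 (ℕ.≤-trans (s≤s z≤n) k<K) ⟩
    1ℤ + + count u 0            ≡⟨ cong (λ n → 1ℤ + + n) (count-none u 0 λ j 1≤j j≤u pj≡0 →
                                     contradiction (ℕ.≤-trans (3≤p (j∈ 1≤j j≤u)) (ℕ.≤-reflexive pj≡0)) λ ()) ⟩
    1ℤ                          ∎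
    where
    open ≡-Reasoning
    q = p (suc u)
    j∈ : ∀ {j} → 1 ≤ j → j ≤ u → Index j
    j∈ 1≤j j≤u = 1≤j , ℕ.≤-trans j≤u (ℕ.≤-trans (ℕ.n≤1+n u) 1+u≤t)
  ... | no q≢k with k ℕ.<? p (suc u)
  ...   | yes k<q = shiftBy-below (p (suc u)) F k<q
  ...   | no k≮q = begin
    shiftBy q F k                       ≡⟨ cong (shiftBy q F) (ℕ.m+[n∸m]≡n q≤k) ⟨
    shiftBy q F (q ℕ.+ (k ∸ q))         ≡⟨ shiftBy-+ˡ q F (k ∸ q) ⟩
    F (k ∸ q)                           ≡⟨ F≡ (k ∸ q) (ℕ.≤-<-trans (ℕ.m∸n≤m k q) k<K) ⟩
    1ₛ (k ∸ q) + + count u (k ∸ q)      ≡⟨ cong₂ (λ a n → a + + n) 1ₛ[k∸q]≡0 (count-none u (k ∸ q) noneAt) ⟩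
    0ℤ                                  ∎
    where
    open ≡-Reasoning
    q = p (suc u)
    q≤k : q ≤ k
    q≤k = ℕ.≮⇒≥ k≮q
    1ₛ[k∸q]≡0 : 1ₛ (k ∸ q) ≡ 0ℤ
    1ₛ[k∸q]≡0 with k ∸ q in eq
    ... | suc _ = refl
    ... | zero = contradiction (ℕ.≤-antisym q≤k (ℕ.m∸n≡0⇒m≤n eq)) q≢k
    noneAt : ∀ j → 1 ≤ j → j ≤ u → p j ≢ k ∸ q
    noneAt j 1≤j j≤u pj≡k∸q = ℕ.<⇒≱ k<K (ℕ.≤-trans
      (K≤p+p (1≤j , ℕ.≤-trans j≤u (ℕ.≤-trans (ℕ.n≤1+n u) 1+u≤t)) (s≤s z≤n , 1+u≤t) (ℕ.<⇒≢ (s≤s j≤u)))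
      (ℕ.≤-reflexive (trans (cong (ℕ._+ q) pj≡k∸q) (ℕ.m∸n+n≡m q≤k))))

  -- Mod y^K no two of the y^{p_j} meet, so ∏ (1 + y^{p_j}) is 1 + Σ y^{p_j}.
  Π-1+y^p : ∀ u → u ≤ t → ∀ k → k < K → (S.Π[≤ u ] (λ j → 1+y^ (p j))) k ≡ 1ₛ k + + count u k
  Π-1+y^p zero _ k _ = sym (ℤ.+-identityʳ _)
  Π-1+y^p (suc u) 1+u≤t k k<K = begin
    (F *ₛ 1+y^ q) k                                 ≡⟨ *ₛ-1+y^ʳ F q k ⟩
    F k + shiftBy q F k                             ≡⟨ cong₂ _+_ (F≡ k k<K) (shiftBy-next-p F 1+u≤t F≡ k k<K) ⟩
    1ₛ k + + count u k + + Σℕ.when (q ℕ.≟ k) 1       ≡⟨ ℤ.+-assoc (1ₛ k) _ _ ⟩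
    1ₛ k + (+ count u k + + Σℕ.when (q ℕ.≟ k) 1)     ≡⟨ cong (λ z → 1ₛ k + z) (ℤ.pos-+ (count u k) _) ⟨
    1ₛ k + + count (suc u) k                        ∎
    where
    open ≡-Reasoning
    q = p (suc u)
    F : Series
    F = S.Π[≤ u ] (λ j → 1+y^ (p j))
    F≡ : ∀ k → k < K → F k ≡ 1ₛ k + + count u k
    F≡ = Π-1+y^p u (ℕ.≤-trans (ℕ.n≤1+n u) 1+u≤t)

  module CoefficientsOfΦN (t-odd : 2 ∤ t) (2≤t : 2 ≤ t) where

    ωOdd-N : ωOdd N ≡ true
    ωOdd-N = trans (ΠX.Π[p∣N] (λ _ → true)) (xor-trues t t-odd)
      where
      open BigOperator _xor_ false
      xor-trues : ∀ n → 2 ∤ n → Π[≤ n ] (λ _ → true) ≡ true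
      xor-trues zero 2∤0 = contradiction (divides 0 refl) 2∤0
      xor-trues (suc zero) _ = refl
      xor-trues (suc (suc n)) 2∤2+n
        rewrite xor-trues n (2∤2+n⇒2∤n 2∤2+n) = refl

    Φʳ-N-recurrence : ∀ k → k < K → Φʳ N k + shift (Φʳ N) k ≡ 1ₛ k + + count t k
    Φʳ-N-recurrence k k<K = begin
      Φʳ N k + shift (Φʳ N) k                   ≡⟨ *ₛ-1+y^ʳ (Φʳ N) 1 k ⟨
      (Φʳ N *ₛ 1+y^ 1) k                        ≡⟨ *ₛ-comm (Φʳ N) (1+y^ 1) k ⟩
      (1+y^ 1 *ₛ Φʳ N) k                        ≡⟨ cong (λ D → (D *ₛ Φʳ N) k) den-N ⟨
      (den N *ₛ Φʳ N) k                         ≡⟨ ΦShape.den*Φʳ≈num (ΦShape-divisor ∣-refl 1≤N) k k<K ⟩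
      num N k                                   ≡⟨ num-N k k<K ⟩
      (S.Π[≤ t ] (λ j → 1+y^ (p j))) k          ≡⟨ Π-1+y^p t ℕ.≤-refl k k<K ⟩
      1ₛ k + + count t k                        ∎
      where
      open ≡-Reasoning
      isEven-N : isEven N ≡ true
      isEven-N = dec-true (2 ∣? N) (m∣m*n (prodRange p t))
      den-N : den N ≡ 1+y^ 1
      den-N rewrite ωOdd-N | isEven-N = refl
      num-N : num N ≈[ K ] S.Π[≤ t ] (λ j → 1+y^ (p j))
      num-N rewrite ωOdd-N | isEven-N = ΠS.Π[p∣N] (λ j → 1+y^ (p j))

    atMost : ℕ → ℕ
    atMost k = Σ[≤ t ] (λ j → Σℕ.when (p j ℕ.≤? k) 1)

    atMost-0 : atMost 0 ≡ 0
    atMost-0 = Σℕ.Π-identity t λ j 1≤j j≤t → absent j (3≤p (1≤j , j≤t))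
      where
      absent : ∀ j → 3 ≤ p j → Σℕ.when (p j ℕ.≤? 0) 1 ≡ 0
      absent j 3≤pj with p j ℕ.≤? 0
      ... | yes pj≤0 = contradiction (ℕ.≤-trans 3≤pj pj≤0) λ ()
      ... | no _ = refl

    atMost-suc : ∀ k → atMost (suc k) ≡ atMost k ℕ.+ count t (suc k)
    atMost-suc k = trans (Σℕ.Π-cong t λ j _ _ → split j) (Σℕ.Π-∙ t _ _)
      where
      split : ∀ j → Σℕ.when (p j ℕ.≤? suc k) 1 ≡ Σℕ.when (p j ℕ.≤? k) 1 ℕ.+ Σℕ.when (p j ℕ.≟ suc k) 1
      split j with p j ℕ.≤? suc k | p j ℕ.≤? k | p j ℕ.≟ suc k
      ... | yes _ | yes _ | no _ = refl
      ... | yes _ | no _ | yes _ = refl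
      ... | no _ | no _ | no _ = refl
      ... | yes pj≤1+k | no pj≰k | no pj≢1+k = contradiction (ℕ.≤-pred (ℕ.≤∧≢⇒< pj≤1+k pj≢1+k)) pj≰k
      ... | _ | yes pj≤k | yes pj≡1+k = contradiction (subst (_≤ k) pj≡1+k pj≤k) (ℕ.n≮n k)
      ... | no pj≰1+k | yes pj≤k | _ = contradiction (ℕ.m≤n⇒m≤1+n pj≤k) pj≰1+k
      ... | no pj≰1+k | no _ | yes pj≡1+k = contradiction (ℕ.≤-reflexive pj≡1+k) pj≰1+k

    count-even : ∀ {n} → 2 ∣ n → count t n ≡ 0
    count-even 2∣n = count-none t _ λ j 1≤j j≤t pj≡n → p-odd (1≤j , j≤t) (subst (2 ∣_) (sym pj≡n) 2∣n)

    -1^-*-count : ∀ n → -1ℤ ^ n * + count t n ≡ - + count t n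
    -1^-*-count n with 2 ∣? n
    ... | yes 2∣n rewrite count-even 2∣n = ℤ.*-zeroʳ (-1ℤ ^ n)
    ... | no 2∤n rewrite -1^-odd n 2∤n = ℤ.-1*i≡-i _

    open ℤ-Solver using (solve; con; _:+_; _:-_; _:*_; :-_; _:=_)

    Φʳ-N : ∀ k → k < K → Φʳ N k ≡ -1ℤ ^ k * (1ℤ - + atMost k)
    Φʳ-N zero 0<K = begin
      Φʳ N 0                   ≡⟨ ℤ.+-identityʳ _ ⟨
      Φʳ N 0 + 0ℤ              ≡⟨ Φʳ-N-recurrence 0 0<K ⟩
      1ℤ + + count t 0         ≡⟨ cong (λ n → 1ℤ + + n) (count-even (divides 0 refl)) ⟩
      1ℤ                       ≡⟨ cong (λ n → 1ℤ * (1ℤ - + n)) atMost-0 ⟨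
      1ℤ * (1ℤ - + atMost 0)   ∎
      where open ≡-Reasoning
    Φʳ-N (suc k) 1+k<K = begin
      Φʳ N (suc k)
        ≡⟨ solve 2 (λ a b → a := (a :+ b) :- b) refl (Φʳ N (suc k)) (Φʳ N k) ⟩
      (Φʳ N (suc k) + Φʳ N k) - Φʳ N k
        ≡⟨ cong₂ _-_ (trans (Φʳ-N-recurrence (suc k) 1+k<K) (ℤ.+-identityˡ c)) (Φʳ-N k (ℕ.<-trans (ℕ.n<1+n k) 1+k<K)) ⟩
      c - s * (1ℤ - + atMost k)
        ≡⟨ solve 3 (λ s a c → c :- s :* (con 1ℤ :- a) := (con -1ℤ :* s) :* (con 1ℤ :- a) :- (:- c)) refl s (+ atMost k) c ⟩
      -1ℤ ^ suc k * (1ℤ - + atMost k) - (- c)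
        ≡⟨ cong (λ z → -1ℤ ^ suc k * (1ℤ - + atMost k) - z) (-1^-*-count (suc k)) ⟨
      -1ℤ ^ suc k * (1ℤ - + atMost k) - -1ℤ ^ suc k * c
        ≡⟨ solve 3 (λ s a c → s :* (con 1ℤ :- a) :- s :* c := s :* (con 1ℤ :- (a :+ c))) refl (-1ℤ ^ suc k) (+ atMost k) c ⟩
      -1ℤ ^ suc k * (1ℤ - (+ atMost k + c))
        ≡⟨ cong (λ n → -1ℤ ^ suc k * (1ℤ - n)) (trans (sym (ℤ.pos-+ (atMost k) _)) (cong +_ (sym (atMost-suc k)))) ⟩
      -1ℤ ^ suc k * (1ℤ - + atMost (suc k))
        ∎
      where
      open ≡-Reasoning
      s c : ℤ
      s = -1ℤ ^ k
      c = + count t (suc k)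

    Σ[≤]-1 : ∀ n → Σ[≤ n ] (λ _ → 1) ≡ n
    Σ[≤]-1 zero = refl
    Σ[≤]-1 (suc n) = trans (cong (ℕ._+ 1) (Σ[≤]-1 n)) (ℕ.+-comm n 1)

    atMost-index : ∀ {j k} → j ≤ t → (∀ i → 1 ≤ i → i ≤ j → p i ≤ k) → (∀ i → j < i → i ≤ t → k < p i) → atMost k ≡ j
    atMost-index {j} {k} j≤t below above = begin
      atMost k
        ≡⟨ cong (λ n → Σ[≤ n ] f) (ℕ.m+[n∸m]≡n j≤t) ⟨
      Σ[≤ j ℕ.+ (t ∸ j) ] f
        ≡⟨ Σℕ.Π-+ j (t ∸ j) f ⟩
      Σ[≤ j ] f ℕ.+ Σ[≤ t ∸ j ] (λ i → f (j ℕ.+ i))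
        ≡⟨ cong₂ ℕ._+_ (Σℕ.Π-cong j counted) (Σℕ.Π-identity (t ∸ j) uncounted) ⟩
      Σ[≤ j ] (λ _ → 1) ℕ.+ 0
        ≡⟨ trans (ℕ.+-identityʳ _) (Σ[≤]-1 j) ⟩
      j
        ∎
      where
      open ≡-Reasoning
      f : ℕ → ℕ
      f i = Σℕ.when (p i ℕ.≤? k) 1
      counted : ∀ i → 1 ≤ i → i ≤ j → Σℕ.when (p i ℕ.≤? k) 1 ≡ 1
      counted i 1≤i i≤j with p i ℕ.≤? k
      ... | yes _ = refl
      ... | no pi≰k = contradiction (below i 1≤i i≤j) pi≰k
      uncounted : ∀ i → 1 ≤ i → i ≤ t ∸ j → Σℕ.when (p (j ℕ.+ i) ℕ.≤? k) 1 ≡ 0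
      uncounted i 1≤i i≤t∸j with p (j ℕ.+ i) ℕ.≤? k
      ... | no _ = refl
      ... | yes p≤k = contradiction p≤k (ℕ.<⇒≱ (above (j ℕ.+ i) (ℕ.m<m+n j 1≤i)
              (ℕ.≤-trans (ℕ.+-monoʳ-≤ j i≤t∸j) (ℕ.≤-reflexive (ℕ.m+[n∸m]≡n j≤t)))))


    1∈ : Index 1
    1∈ = s≤s z≤n , ℕ.≤-trans (s≤s z≤n) 2≤t

    2∈ : Index 2
    2∈ = s≤s z≤n , 2≤t

    K≤1+φ-N : K ≤ suc (φ N)
    K≤1+φ-N = ℕ.≤-trans (K≤1+[p∸1]*[p∸1] 1∈ 2∈ (λ ())) (s≤s (begin
      (p 1 ∸ 1) ℕ.* (p 2 ∸ 1)       ≡⟨ cong (ℕ._* (p 2 ∸ 1)) (ℕ.*-identityˡ (p 1 ∸ 1)) ⟨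
      Π[≤ 2 ] (λ j → p j ∸ 1)       ≤⟨ grow t 2≤t ℕ.≤-refl ⟩
      Π[≤ t ] (λ j → p j ∸ 1)       ≡⟨ Πℕ.Π[p∣N] (λ j → p j ∸ 1) ⟨
      φ N                           ∎))
      where
      open ℕ.≤-Reasoning
      open BigOperator ℕ._*_ 1
      grow : ∀ u → 2 ≤ u → u ≤ t → Π[≤ 2 ] (λ j → p j ∸ 1) ≤ Π[≤ u ] (λ j → p j ∸ 1)
      grow (suc zero) (s≤s ()) _
      grow (suc (suc zero)) _ _ = ℕ.≤-refl
      grow (suc (suc (suc u))) _ 3+u≤t = ℕ.≤-trans (grow (suc (suc u)) (s≤s (s≤s z≤n)) (ℕ.≤-trans (ℕ.n≤1+n _) 3+u≤t))
        (ℕ.m≤m*n _ (p (3 ℕ.+ u) ∸ 1) {{ℕ.>-nonZero (ℕ.∸-monoˡ-≤ 1 (ℕ.≤-trans (s≤s (s≤s z≤n)) (3≤p (s≤s z≤n , 3+u≤t))))}})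

    Φ-N-coefficient : ∀ k → k < K → IsCoefficientOf (-1ℤ ^ k * (1ℤ - + atMost k)) (Φ N)
    Φ-N-coefficient k k<K = subst (λ c → IsCoefficientOf c (Φ N)) (Φʳ-N k k<K)
      (reverse-isCoefficient (Φ N) k (subst (k <_) (sym (ΦShape.length-Φ≡ (ΦShape-divisor ∣-refl 1≤N))) (ℕ.<-≤-trans k<K K≤1+φ-N)))

    atMost-p : ∀ {j} → Index j → atMost (p j) ≡ j
    atMost-p {j} (1≤j , j≤t) = atMost-index j≤t (λ i 1≤i i≤j → p≤p 1≤i i≤j j≤t) (λ i j<i i≤t → p-increasing j i 1≤j j<i i≤t)

    atMost-1+p : ∀ {j} → Index j → (j < t → suc (p j) < p (suc j)) → atMost (suc (p j)) ≡ j
    atMost-1+p {j} (1≤j , j≤t) gap = atMost-index j≤t (λ i 1≤i i≤j → ℕ.m≤n⇒m≤1+n (p≤p 1≤i i≤j j≤t))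
      (λ i j<i i≤t → ℕ.<-≤-trans (gap (ℕ.<-≤-trans j<i i≤t)) (p≤p (s≤s z≤n) j<i i≤t))

    p-coefficient : ∀ {j} → Index j → p j < K → IsCoefficientOf (- (1ℤ - + j)) (Φ N)
    p-coefficient {j} j∈ pj<K = subst (λ c → IsCoefficientOf c (Φ N)) value (Φ-N-coefficient (p j) pj<K)
      where
      value : -1ℤ ^ p j * (1ℤ - + atMost (p j)) ≡ - (1ℤ - + j)
      value rewrite atMost-p j∈ | -1^-odd (p j) (p-odd j∈) = ℤ.-1*i≡-i _

    1+p-coefficient : ∀ {j} → Index j → (j < t → suc (p j) < p (suc j)) → suc (p j) < K → IsCoefficientOf (1ℤ - + j) (Φ N)
    1+p-coefficient {j} j∈ gap 1+pj<K = subst (λ c → IsCoefficientOf c (Φ N)) value (Φ-N-coefficient (suc (p j)) 1+pj<K)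
      where
      value : -1ℤ ^ suc (p j) * (1ℤ - + atMost (suc (p j))) ≡ 1ℤ - + j
      value rewrite atMost-1+p j∈ gap | -1^-odd (p j) (p-odd j∈) = ℤ.*-identityˡ _

    coefficient-range : ∀ r → r ≤ t → p r < K → ∀ c → - (+ r - + 2) ℤ.≤ c → c ℤ.≤ + r - + 1 → IsCoefficientOf c (Φ N)
    coefficient-range zero _ _ c lo hi = contradiction (ℤ.≤-trans lo hi) λ ()
    coefficient-range (suc zero) _ _ c lo hi = contradiction (ℤ.≤-trans lo hi) λ { (ℤ.+≤+ ()) }
    coefficient-range (suc r′) r≤t pr<K (+ n) _ hi = subst (λ c → IsCoefficientOf c (Φ N))
      (solve 1 (λ x → :- (con 1ℤ :- (con 1ℤ :+ x)) := x) refl (+ n))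
      (p-coefficient j∈ (ℕ.≤-<-trans (p≤p (s≤s z≤n) j≤r r≤t) pr<K))
      where
      j≤r : suc n ≤ suc r′
      j≤r = s≤s (ℤ.drop‿+≤+ hi)
      j∈ : Index (suc n)
      j∈ = s≤s z≤n , ℕ.≤-trans j≤r r≤t
    coefficient-range (suc (suc zero)) _ _ -[1+ n ] () _
    coefficient-range (suc (suc (suc r′))) r≤t pr<K -[1+ n ] (ℤ.-≤- n≤r′) _ =
      1+p-coefficient j∈ (λ _ → gap) (ℕ.<-≤-trans gap (ℕ.≤-trans (p≤p (s≤s z≤n) (s≤s (s≤s (s≤s n≤r′))) r≤t) (ℕ.<⇒≤ pr<K)))
      where
      j∈ : Index (suc (suc n))
      j∈ = s≤s z≤n , ℕ.≤-trans (s≤s (s≤s (ℕ.m≤n⇒m≤1+n n≤r′))) r≤t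
      1+j∈ : Index (suc (suc (suc n)))
      1+j∈ = s≤s z≤n , ℕ.≤-trans (s≤s (s≤s (s≤s n≤r′))) r≤t
      gap : suc (p (suc (suc n))) < p (suc (suc (suc n)))
      gap = odd-m<n⇒1+m<n (p-odd j∈) (p-odd 1+j∈) (p-increasing _ _ (s≤s z≤n) ℕ.≤-refl (proj₂ 1+j∈))

    extra-coefficient : ∀ {r} → Index r → (r < t → K < p (suc r)) → suc (p r) < K → IsCoefficientOf (1ℤ - + r) (Φ N)
    extra-coefficient r∈ K<p[1+r] 1+pr<K = 1+p-coefficient r∈ (λ r<t → ℕ.<-trans 1+pr<K (K<p[1+r] r<t)) 1+pr<K

open import Data.Nat using (_+_; _*_)
open import Data.Integer as ℤ using (ℤ; +_; -_; _-_)
import Data.Nat.Properties as ℕ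

mainTheorem4 : (t : ℕ) → 3 ≤ t → ¬ (2 ∣ t) →
    (p : ℕ → ℕ) →
    (∀ i → 1 ≤ i → i ≤ t → Prime (p i) × ¬ (2 ∣ p i)) →
    (∀ i j → 1 ≤ i → i < j → j ≤ t → p i < p j) →
    (r : ℕ) → 1 ≤ r → r ≤ t →
    p r < p 1 + p 2 →
    (r < t → p 1 + p 2 < p (suc r)) →
    ((c : ℤ) → - (+ r - + 2) ℤ.≤ c → c ℤ.≤ + r - + 1 →
       IsCoefficientOf c (Φ (2 * prodRange p t)))
    × (suc (p r) < p 1 + p 2 →
       IsCoefficientOf (+ 1 - + r) (Φ (2 * prodRange p t)))
mainTheorem4 t 3≤t t-odd p p-prime-odd p-increasing r 1≤r r≤t pr<K K<p[1+r] =
  coefficient-range r r≤t pr<K , extra-coefficient (1≤r , r≤t) K<p[1+r]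
  where
  open OddPrimes t p p-prime-odd p-increasing
  open CoefficientsOfΦN t-odd (ℕ.≤-trans (ℕ.n≤1+n 2) 3≤t)
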